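{- Let $k\ge 3$ be an integer and let $G_{\widehat{\mathcal{GP}}_k}([n])$ be the largest possible size of a subset of $[n]=\{1,\dots,n\}$ that does not contain any $k$-term geometric progression with integer or rational ratio, i.e. no subset of the form $\{a,ar,ar^2,\dots,ar^{k-1}\}$ with $a\in\mathbb{N}$ and $r$ a positive rational number, $r\neq 1$. Then \[ \limsup_{n \to \infty} \frac{G_{\widehat{\mathcal{GP}}_k}([n])}{n} \leq 1 - \frac{2^k}{2^k-1} \sum_{d=1}^\infty ( k c'_{d-1,k} - c'_{d,k}) \frac{\varphi(P_d)}{P_d^{k}}, \] where $P_d$ is the product of the first $d$ primes, $\varphi$ is Euler's phi function, and $c'_{d,k}$ are the Moser numbers.
   Context: $c'_{d,k}$ denotes the largest possible size of a subset of $\{0,1,\dots,k-1\}^d$ containing no geometric line. A geometric line is a set of $k$ distinct points $x_0,\dots,x_{k-1}\in\{0,\dots,k-1\}^d$ whose coordinates fall into three classes: coordinates that are constant, coordinates in which $x_j$ has value $j$ (counting up from $0$ to $k-1$), and a possibly empty class of coordinates in which $x_j$ has value $k-1-j$ (counting down from $k-1$ to $0$). In particular $c'_{0,k}=1$. -}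

module Defs where

open import Data.Nat using (ℕ; zero; suc; _∸_; _+_; _*_; _^_; _≤_; _<_)
open import Data.Nat.Primality using (Prime)
open import Data.Nat.Coprimality using (coprime?)
open import Data.Integer as ℤ using (ℤ; +_)
open import Data.Rational as ℚ using (ℚ; _/_; 0ℚ)
open import Data.Fin using (Fin; opposite)
open import Data.Vec using (Vec; tabulate)
open import Data.List using (List; length; filter; upTo; map)
open import Data.Nat.ListAction using (product)
open import Data.List.Membership.Propositional using (_∈_)
open import Data.List.Relation.Unary.Unique.Propositional using (Unique)
open import Data.Product using (Σ; ∃; ∃-syntax; _×_)
open import Relation.Binary.PropositionalEquality using (_≡_)
open import Relation.Nullary using (¬_)

-- The class of a coordinate of a geometric line in {0,…,k-1}^d.
data Class (k : ℕ) : Set where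
  const : Fin k → Class k
  up    : Class k
  down  : Class k

classVal : ∀ {k} → Class k → Fin k → Fin k
classVal (const c) j = c
classVal up        j = j
classVal down      j = opposite j

linePoint : ∀ {d k} → (Fin d → Class k) → Fin k → Vec (Fin k) d
linePoint s j = tabulate (λ i → classVal (s i) j)

IsGeomLine : ∀ {d k} → (Fin d → Class k) → Set
IsGeomLine {d} {k} s = ∀ (j j′ : Fin k) → linePoint s j ≡ linePoint s j′ → j ≡ j′

LineFree : ∀ {d k} → List (Vec (Fin k) d) → Set
LineFree {d} {k} A =
  ¬ (Σ (Fin d → Class k) λ s → IsGeomLine s × (∀ (j : Fin k) → linePoint s j ∈ A))

IsMoserNumber : ℕ → ℕ → ℕ → Set
IsMoserNumber d k m =
  (Σ (List (Vec (Fin k) d)) λ A → Unique A × LineFree A × length A ≡ m)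
  × (∀ (A : List (Vec (Fin k) d)) → Unique A → LineFree A → length A ≤ m)

InRange : ℕ → ℕ → Set
InRange n x = 1 ≤ x × x ≤ n

-- A (list of elements of ℕ) contains a k-term geometric progression
-- a, a r, …, a r^(k-1) with a ∈ ℕ and ratio r = p/q a positive rational, r ≠ 1.
-- The term a r^i is the natural number x with x * q^i = a * p^i.
ContainsGP : ℕ → List ℕ → Set
ContainsGP k A =
  Σ ℕ λ a → Σ ℕ λ p → Σ ℕ λ q →
    1 ≤ p × 1 ≤ q × ¬ (p ≡ q) ×
    (∀ i → i < k → Σ ℕ λ x → x ∈ A × x * q ^ i ≡ a * p ^ i)

IsMaxGPFree : ℕ → ℕ → ℕ → Set
IsMaxGPFree k n m =
  (Σ (List ℕ) λ A → Unique A × (∀ x → x ∈ A → InRange n x) × ¬ ContainsGP k A × length A ≡ m)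
  × (∀ (A : List ℕ) → Unique A → (∀ x → x ∈ A → InRange n x) → ¬ ContainsGP k A → length A ≤ m)

IsPrimeEnumeration : (ℕ → ℕ) → Set
IsPrimeEnumeration p =
  (∀ i → Prime (p i)) × (∀ i j → i < j → p i < p j) × (∀ q → Prime q → ∃[ i ] p i ≡ q)

primorial : (ℕ → ℕ) → ℕ → ℕ
primorial p d = product (map p (upTo d))

φ : ℕ → ℕ
φ m = length (filter (coprime? m) (map suc (upTo m)))

-- a / b as a rational, with the (unused) convention a / 0 = 0
frac : ℤ → ℕ → ℚ
frac a zero    = 0ℚ
frac a (suc b) = a / suc b

-- (suc e)-th summand, d = e + 1 ≥ 1:
--   (k c'_{d-1,k} - c'_{d,k}) φ(P_d) / P_d^k
summand : ℕ → (ℕ → ℕ) → (ℕ → ℕ) → ℕ → ℚ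
summand k c p e =
  frac ((+ (k * c e) ℤ.- + c (suc e)) ℤ.* + φ (primorial p (suc e)))
       (primorial p (suc e) ^ k)

partialSum : ℕ → (ℕ → ℕ) → (ℕ → ℕ) → ℕ → ℚ
partialSum k c p zero    = 0ℚ
partialSum k c p (suc D) = partialSum k c p D ℚ.+ summand k c p D

factor : ℕ → ℚ
factor k = frac (+ (2 ^ k)) (2 ^ k ∸ 1)

module Submission where

-- Let A ⊆ [n] be GP_k-free.  Multiplying a base point b by prime powers,
-- b · p(d-1)^v₀ ⋯ p 0^v_{d-1}, embeds the cube [k]^d into ℕ and sends every
-- geometric line to a k-term geometric progression (LinesToProgressions).  So
-- A meets every such cube in a line-free set, of size at most the Moser
-- number c'_{d,k}; moreover c'_{d+1,k} ≤ k c'_{d,k} (MoserNumbers).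
-- We cover [n] by disjoint cubes of increasing dimension (CubePacking): a
-- cube of level e+1 splits into k cubes of level e, so A misses at least
-- k c'_e - c'_{e+1} more points at level e than at level e+1.  Telescoping
-- over the levels gives  |A| + Σ_e N_{e+1} (k c'_e - c'_{e+1}) ≤ n,  where the
-- number N_{e+1} of cubes of level e+1 is bounded below by counting integers
-- coprime to the primorial P_{e+1} (Totients).  Dividing by n turns this
-- into  |A|/n ≤ 1 - (Σ_{t<T} 2^{-kt}) S_D + T K/n  with S_D the D-th partial
-- sum of the series (Estimates.DensityBound, Conclusion.Truncation).
-- Finally the summands decay like (3/4)^e (SeriesBounds), the geometric
-- series tends to 2^k/(2^k-1), and all error terms are made ≤ ε/3.

module FiniteSums where

  open import Data.Nat using (ℕ; zero; suc; _+_; _*_; _∸_; _≤_; _<_; z≤n; s≤s)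
  open import Data.Nat.Properties
  open import Algebra.Properties.CommutativeSemigroup +-commutativeSemigroup
    using () renaming (interchange to +-interchange; x∙yz≈y∙xz to x+[y+z]≡y+[x+z])
  open import Data.List using (List; []; _∷_; _++_; map; concatMap; length; filter; upTo)
  open import Data.List.Properties using (length-map; length-upTo; upTo-∷ʳ)
  open import Data.List.Membership.Propositional using (_∈_; _∉_; find; lose)
  open import Data.List.Membership.Propositional.Properties using (∈-map⁺; ∈-map⁻; ∈-concatMap⁺; ∈-concatMap⁻; ∈-upTo⁺; ∈-upTo⁻)
  open import Data.List.Relation.Unary.Any using (here; there)
  open import Data.List.Relation.Unary.All using (lookup; tabulate)
  open import Data.List.Relation.Unary.AllPairs using ([]; _∷_)
  open import Data.List.Relation.Unary.Unique.Propositional using (Unique)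
  open import Data.List.Relation.Unary.Unique.Propositional.Properties using (++⁺; map⁺; upTo⁺)
  open import Data.Product using (Σ; _×_; _,_)
  open import Data.Empty using (⊥)
  open import Relation.Nullary using (Dec; yes; no; contradiction)
  open import Relation.Unary using (Decidable)
  open import Relation.Binary.Definitions using (DecidableEquality)
  open import Relation.Binary.PropositionalEquality using (_≡_; refl; sym; trans; cong; cong₂; module ≡-Reasoning)

  private variable X Y : Set

  sumL : (X → ℕ) → List X → ℕ
  sumL f []       = 0
  sumL f (x ∷ xs) = f x + sumL f xs

  indicator : {P : Set} → Dec P → ℕ
  indicator (yes _) = 1
  indicator (no _)  = 0

  indicator≤1 : {P : Set} (P? : Dec P) → indicator P? ≤ 1
  indicator≤1 (yes _) = ≤-refl
  indicator≤1 (no _)  = z≤n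

  sumL-++ : (f : X → ℕ) (xs ys : List X) → sumL f (xs ++ ys) ≡ sumL f xs + sumL f ys
  sumL-++ f []       ys = refl
  sumL-++ f (x ∷ xs) ys = trans (cong (f x +_) (sumL-++ f xs ys)) (sym (+-assoc (f x) _ _))

  sumL-map : (f : Y → ℕ) (g : X → Y) (xs : List X) → sumL f (map g xs) ≡ sumL (λ x → f (g x)) xs
  sumL-map f g []       = refl
  sumL-map f g (x ∷ xs) = cong (f (g x) +_) (sumL-map f g xs)

  sumL-concatMap : (f : Y → ℕ) (h : X → List Y) (xs : List X) →
                   sumL f (concatMap h xs) ≡ sumL (λ x → sumL f (h x)) xs
  sumL-concatMap f h []       = refl
  sumL-concatMap f h (x ∷ xs) =
    trans (sumL-++ f (h x) (concatMap h xs)) (cong (sumL f (h x) +_) (sumL-concatMap f h xs))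

  sumL-cong : (f g : X → ℕ) (xs : List X) → (∀ {x} → x ∈ xs → f x ≡ g x) → sumL f xs ≡ sumL g xs
  sumL-cong f g []       h = refl
  sumL-cong f g (x ∷ xs) h = cong₂ _+_ (h (here refl)) (sumL-cong f g xs (λ m → h (there m)))

  sumL-mono : (f g : X → ℕ) (xs : List X) → (∀ {x} → x ∈ xs → f x ≤ g x) → sumL f xs ≤ sumL g xs
  sumL-mono f g []       h = z≤n
  sumL-mono f g (x ∷ xs) h = +-mono-≤ (h (here refl)) (sumL-mono f g xs (λ m → h (there m)))

  sumL-const : (c : ℕ) (xs : List X) → sumL (λ _ → c) xs ≡ length xs * c
  sumL-const c []       = refl
  sumL-const c (x ∷ xs) = cong (c +_) (sumL-const c xs)

  sumL-+ : (f g : X → ℕ) (xs : List X) → sumL (λ x → f x + g x) xs ≡ sumL f xs + sumL g xs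
  sumL-+ f g []       = refl
  sumL-+ f g (x ∷ xs) = trans (cong (f x + g x +_) (sumL-+ f g xs)) (+-interchange (f x) (g x) _ _)

  sumL-complement+sumL : (c : ℕ) (f : X → ℕ) (xs : List X) → (∀ {x} → x ∈ xs → f x ≤ c) →
                         sumL (λ x → c ∸ f x) xs + sumL f xs ≡ length xs * c
  sumL-complement+sumL c f xs f≤c =
    trans (sym (sumL-+ (λ x → c ∸ f x) f xs))
          (trans (sumL-cong _ (λ _ → c) xs (λ x∈ → m∸n+n≡m (f≤c x∈))) (sumL-const c xs))

  sumL-complement : (c : ℕ) (f : X → ℕ) (xs : List X) → (∀ {x} → x ∈ xs → f x ≤ c) →
                    sumL (λ x → c ∸ f x) xs ≡ length xs * c ∸ sumL f xs
  sumL-complement c f xs f≤c =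
    trans (sym (m+n∸n≡m (sumL (λ x → c ∸ f x) xs) (sumL f xs))) (cong (_∸ sumL f xs) (sumL-complement+sumL c f xs f≤c))

  length-filter≡sumL : {P : X → Set} (P? : Decidable P) (xs : List X) →
                       length (filter P? xs) ≡ sumL (λ x → indicator (P? x)) xs
  length-filter≡sumL P? []       = refl
  length-filter≡sumL P? (x ∷ xs) with P? x
  ... | yes _ = cong suc (length-filter≡sumL P? xs)
  ... | no _  = length-filter≡sumL P? xs

  length≡sumL : (xs : List X) → length xs ≡ sumL (λ _ → 1) xs
  length≡sumL []       = refl
  length≡sumL (x ∷ xs) = cong suc (length≡sumL xs)

  ∈-concatMap-intro : (h : X → List Y) {x : X} {y : Y} {xs : List X} →
                      x ∈ xs → y ∈ h x → y ∈ concatMap h xs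
  ∈-concatMap-intro h x∈xs y∈hx = ∈-concatMap⁺ h (lose x∈xs y∈hx)

  ∈-concatMap-elim : (h : X → List Y) {y : Y} (xs : List X) →
                     y ∈ concatMap h xs → Σ X λ x → x ∈ xs × y ∈ h x
  ∈-concatMap-elim h xs y∈ = find (∈-concatMap⁻ h y∈)

  unique-concatMap : (h : X → List Y) (xs : List X) → Unique xs →
    (∀ {x} → x ∈ xs → Unique (h x)) →
    (∀ {x x′ y} → x ∈ xs → x′ ∈ xs → y ∈ h x → y ∈ h x′ → x ≡ x′) →
    Unique (concatMap h xs)
  unique-concatMap h []       _          _      _        = []
  unique-concatMap h (x ∷ xs) (x∉ ∷ uxs) unique disjoint =
    ++⁺ (unique (here refl))
        (unique-concatMap h xs uxs (λ m → unique (there m)) (λ m m′ → disjoint (there m) (there m′)))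
        λ (y∈hx , y∈rest) → let (x′ , x′∈xs , y∈hx′) = ∈-concatMap-elim h xs y∈rest
                             in lookup x∉ x′∈xs (disjoint (here refl) (there x′∈xs) y∈hx y∈hx′)

  unique-map : (g : X → Y) (xs : List X) → Unique xs →
    (∀ {x x′} → x ∈ xs → x′ ∈ xs → g x ≡ g x′ → x ≡ x′) → Unique (map g xs)
  unique-map g []       _          _   = []
  unique-map g (x ∷ xs) (x∉ ∷ uxs) inj =
    tabulate gx∉ ∷ unique-map g xs uxs (λ m m′ → inj (there m) (there m′))
    where
    gx∉ : ∀ {y} → y ∈ map g xs → g x ≡ y → ⊥
    gx∉ y∈ eq with ∈-map⁻ g y∈
    ... | (x′ , x′∈xs , refl) = lookup x∉ x′∈xs (inj (here refl) (there x′∈xs) eq)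

  module _ (_≟_ : DecidableEquality X) where
    open import Data.List.Membership.DecPropositional _≟_ using (_∈?_)

    private
      without : (X → ℕ) → X → X → ℕ
      without f y x with x ≟ y
      ... | yes _ = 0
      ... | no _  = f x

      without≤ : (f : X → ℕ) (y x : X) → without f y x ≤ f x
      without≤ f y x with x ≟ y
      ... | yes _ = z≤n
      ... | no _  = ≤-refl

      sumL-without : (f : X → ℕ) (y : X) (U : List X) → y ∈ U → f y + sumL (without f y) U ≤ sumL f U
      sumL-without f y (u ∷ U) (here refl) with u ≟ u
      ... | yes _ = +-monoʳ-≤ (f u) (sumL-mono (without f u) f U (λ {x} _ → without≤ f u x))
      ... | no u≢u = contradiction refl u≢u
      sumL-without f y (u ∷ U) (there y∈U) = begin
        f y + (without f y u + sumL (without f y) U) ≡⟨ x+[y+z]≡y+[x+z] (f y) (without f y u) (sumL (without f y) U) ⟩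
        without f y u + (f y + sumL (without f y) U) ≤⟨ +-mono-≤ (without≤ f y u) (sumL-without f y U y∈U) ⟩
        f u + sumL f U                               ∎
        where open ≤-Reasoning

      sumL-without-∉ : (f : X → ℕ) (y : X) (L : List X) → y ∉ L → sumL (without f y) L ≡ sumL f L
      sumL-without-∉ f y []      _  = refl
      sumL-without-∉ f y (x ∷ L) y∉ with x ≟ y
      ... | yes refl = contradiction (here refl) y∉
      ... | no _     = cong (f x +_) (sumL-without-∉ f y L (λ m → y∉ (there m)))

    -- The f-sum over a duplicate-free list L contained in U is at most the
    -- f-sum over U.  Proof: remove the first element y of L from U by setting
    -- f to 0 at y, and recurse.
    sumL-⊆ : (f : X → ℕ) (L U : List X) → Unique L → (∀ {x} → x ∈ L → x ∈ U) → sumL f L ≤ sumL f U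
    sumL-⊆ f []      U _          _   = z≤n
    sumL-⊆ f (y ∷ L) U (y∉ ∷ uL) L⊆U = begin
      f y + sumL f L                 ≡⟨ cong (f y +_) (sym (sumL-without-∉ f y L (λ m → lookup y∉ m refl))) ⟩
      f y + sumL (without f y) L     ≤⟨ +-monoʳ-≤ (f y) (sumL-⊆ (without f y) L U uL (λ m → L⊆U (there m))) ⟩
      f y + sumL (without f y) U     ≤⟨ sumL-without f y U (L⊆U (here refl)) ⟩
      sumL f U                       ∎
      where open ≤-Reasoning

    length-⊆ : (L U : List X) → Unique L → (∀ {x} → x ∈ L → x ∈ U) → length L ≤ length U
    length-⊆ L U uL L⊆U = begin
      length L           ≡⟨ length≡sumL L ⟩
      sumL (λ _ → 1) L   ≤⟨ sumL-⊆ (λ _ → 1) L U uL L⊆U ⟩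
      sumL (λ _ → 1) U   ≡⟨ sym (length≡sumL U) ⟩
      length U           ∎
      where open ≤-Reasoning

    length≤count : (L U : List X) → Unique L → (∀ {x} → x ∈ L → x ∈ U) →
                   length L ≤ sumL (λ x → indicator (x ∈? L)) U
    length≤count L U uL L⊆U = begin
      length L                             ≡⟨ length≡sumL L ⟩
      sumL (λ _ → 1) L                     ≡⟨ sumL-cong _ _ L (λ x∈L → sym (indicator-yes x∈L)) ⟩
      sumL (λ x → indicator (x ∈? L)) L    ≤⟨ sumL-⊆ _ L U uL L⊆U ⟩
      sumL (λ x → indicator (x ∈? L)) U    ∎
      where
      open ≤-Reasoning
      indicator-yes : ∀ {x} → x ∈ L → indicator (x ∈? L) ≡ 1
      indicator-yes {x} x∈L with x ∈? L
      ... | yes _   = refl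
      ... | no x∉L = contradiction x∈L x∉L

  sumBelow : ℕ → (ℕ → ℕ) → ℕ
  sumBelow zero    f = 0
  sumBelow (suc D) f = sumBelow D f + f D

  sumBelow-mono : ∀ D f g → (∀ e → f e ≤ g e) → sumBelow D f ≤ sumBelow D g
  sumBelow-mono zero    f g f≤g = z≤n
  sumBelow-mono (suc D) f g f≤g = +-mono-≤ (sumBelow-mono D f g f≤g) (f≤g D)

  sumBelow-*ʳ : ∀ D f c → sumBelow D (λ e → f e * c) ≡ sumBelow D f * c
  sumBelow-*ʳ zero    f c = refl
  sumBelow-*ʳ (suc D) f c = trans (cong (_+ f D * c) (sumBelow-*ʳ D f c)) (sym (*-distribʳ-+ c (sumBelow D f) (f D)))

  sumL-upTo : (f : ℕ → ℕ) (D : ℕ) → sumL f (upTo D) ≡ sumBelow D f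
  sumL-upTo f zero    = refl
  sumL-upTo f (suc D) = begin
    sumL f (upTo (suc D))          ≡⟨ cong (sumL f) (sym (upTo-∷ʳ D)) ⟩
    sumL f (upTo D ++ D ∷ [])      ≡⟨ sumL-++ f (upTo D) (D ∷ []) ⟩
    sumL f (upTo D) + (f D + 0)    ≡⟨ cong₂ _+_ (sumL-upTo f D) (+-identityʳ (f D)) ⟩
    sumBelow D f + f D             ∎
    where open ≡-Reasoning

  interval : ℕ → List ℕ
  interval n = map suc (upTo n)

  ∈-interval⁺ : ∀ {n m} → 0 < m → m ≤ n → m ∈ interval n
  ∈-interval⁺ {m = suc m} _ m≤n = ∈-map⁺ suc (∈-upTo⁺ m≤n)

  ∈-interval⁻ : ∀ {n m} → m ∈ interval n → 0 < m × m ≤ n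
  ∈-interval⁻ m∈ with ∈-map⁻ suc m∈
  ... | (_ , i∈ , refl) = s≤s z≤n , ∈-upTo⁻ i∈

  interval-unique : ∀ n → Unique (interval n)
  interval-unique n = map⁺ suc-injective (upTo⁺ n)

  length-interval : ∀ n → length (interval n) ≡ n
  length-interval n = trans (length-map suc (upTo n)) (length-upTo n)


module NumberTheory where

  open import Defs using (primorial)
  open import Data.Nat using (ℕ; zero; suc; _+_; _*_; _^_; _≤_; _<_; z≤n; s≤s; NonZero; nonTrivial⇒≢1)
  open import Data.Nat.Properties
  open import Algebra.Properties.CommutativeSemigroup *-commutativeSemigroup
    using () renaming (interchange to *-interchange; x∙yz≈xz∙y to x*[y*z]≡x*z*y; x∙yz≈y∙xz to x*[y*z]≡y*[x*z])
  open import Data.Nat.DivMod using (_%_; [m+kn]%n≡m%n; m<n⇒m%n≡m)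
  open import Data.Nat.Divisibility using (_∣_; divides; ∣1⇒≡1; ∣-refl; ∣-trans; ∣m⇒∣m*n; ∣n⇒∣m*n)
  open import Data.Nat.Coprimality using (Coprime; coprime-divisor)
  open import Data.Nat.Primality using (Prime; euclidsLemma; prime⇒irreducible; prime⇒nonZero; prime⇒nonTrivial)
  open import Data.Nat.ListAction using (product)
  open import Data.Nat.ListAction.Properties using (product-++)
  open import Data.List using ([]; _∷_; map; upTo)
  open import Data.List.Properties using (upTo-∷ʳ; map-++)
  open import Data.Product using (_×_; _,_)
  open import Data.Sum using (inj₁; inj₂)
  open import Relation.Nullary using (¬_; contradiction)
  open import Relation.Binary.PropositionalEquality using (_≡_; refl; sym; trans; cong; subst)

  prime≥2 : ∀ {q} → Prime q → 2 ≤ q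
  prime≥2 {0} q-prime with () ← prime⇒nonZero q-prime
  prime≥2 {1} q-prime = contradiction refl (nonTrivial⇒≢1 {{prime⇒nonTrivial q-prime}})
  prime≥2 {suc (suc q)} _ = s≤s (s≤s z≤n)

  ^>0 : ∀ {a} → 0 < a → ∀ j → 0 < a ^ j
  ^>0 a>0 zero    = s≤s z≤n
  ^>0 a>0 (suc j) = *-mono-≤ a>0 (^>0 a>0 j)

  ≤*pos : ∀ a {b} → 0 < b → a ≤ a * b
  ≤*pos a b>0 = ≤-trans (≤-reflexive (sym (*-identityʳ a))) (*-monoʳ-≤ a b>0)

  ^-distribʳ-* : ∀ a b j → (a * b) ^ j ≡ a ^ j * b ^ j
  ^-distribʳ-* a b zero    = refl
  ^-distribʳ-* a b (suc j) = trans (cong (a * b *_) (^-distribʳ-* a b j)) (*-interchange a b (a ^ j) (b ^ j))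

  prime-power-cancel : ∀ q → Prime q → ∀ a b → ¬ (q ∣ a) → ¬ (q ∣ b) →
                       ∀ i j → a * q ^ i ≡ b * q ^ j → i ≡ j × a ≡ b
  prime-power-cancel q _ a b _ _ zero zero eq = refl , trans (sym (*-identityʳ a)) (trans eq (*-identityʳ b))
  prime-power-cancel q _ a b q∤a _ zero (suc j) eq =
    contradiction (divides (b * q ^ j) (trans (sym (*-identityʳ a)) (trans eq (x*[y*z]≡x*z*y b q (q ^ j))))) q∤a
  prime-power-cancel q q-prime a b q∤a q∤b (suc i) zero eq =
    let (j≡i , b≡a) = prime-power-cancel q q-prime b a q∤b q∤a zero (suc i) (sym eq) in sym j≡i , sym b≡a
  prime-power-cancel q q-prime a b q∤a q∤b (suc i) (suc j) eq
    with prime-power-cancel q q-prime a b q∤a q∤b i j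
           (*-cancelˡ-≡ (a * q ^ i) (b * q ^ j) q {{prime⇒nonZero q-prime}}
              (trans (x*[y*z]≡y*[x*z] q a (q ^ i)) (trans eq (sym (x*[y*z]≡y*[x*z] q b (q ^ j))))))
  ... | (i≡j , a≡b) = cong suc i≡j , a≡b

  divmod-unique : ∀ k .{{_ : NonZero k}} {t t′ j j′} → j < k → j′ < k →
                  t * k + j ≡ t′ * k + j′ → t ≡ t′ × j ≡ j′
  divmod-unique k {t} {t′} {j} {j′} j<k j′<k eq = t≡t′ , j≡j′
    where
    eq′ : j + t * k ≡ j′ + t′ * k
    eq′ = trans (+-comm j (t * k)) (trans eq (+-comm (t′ * k) j′))
    j≡j′ : j ≡ j′
    j≡j′ = trans (sym (m<n⇒m%n≡m j<k)) (trans (sym ([m+kn]%n≡m%n j t k))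
             (trans (cong (_% k) eq′) (trans ([m+kn]%n≡m%n j′ t′ k) (m<n⇒m%n≡m j′<k))))
    t≡t′ : t ≡ t′
    t≡t′ = *-cancelʳ-≡ t t′ k (+-cancelʳ-≡ j (t * k) (t′ * k) (trans eq (cong (t′ * k +_) (sym j≡j′))))

  coprime-∣ˡ : ∀ {a b a′} → Coprime a b → a′ ∣ a → Coprime a′ b
  coprime-∣ˡ a⊥b a′∣a (i∣a′ , i∣b) = a⊥b (∣-trans i∣a′ a′∣a , i∣b)

  coprime-* : ∀ {a b c} → Coprime a b → Coprime a c → Coprime a (b * c)
  coprime-* a⊥b a⊥c (i∣a , i∣bc) = a⊥c (i∣a , coprime-divisor (coprime-∣ˡ a⊥b i∣a) i∣bc)

  coprime-^ : ∀ {a b} j → Coprime a b → Coprime a (b ^ j)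
  coprime-^ zero    _   (_ , i∣1) = ∣1⇒≡1 i∣1
  coprime-^ (suc j) a⊥b = coprime-* a⊥b (coprime-^ j a⊥b)

  module Primorials (p : ℕ → ℕ) (p-prime : ∀ i → Prime (p i)) (p-increasing : ∀ i j → i < j → p i < p j) where

    P : ℕ → ℕ
    P = primorial p

    P-suc : ∀ d → P (suc d) ≡ P d * p d
    P-suc d = trans (cong (λ xs → product (map p xs)) (sym (upTo-∷ʳ d)))
                (trans (cong product (map-++ p (upTo d) (d ∷ [])))
                (trans (product-++ (map p (upTo d)) (p d ∷ [])) (cong (P d *_) (*-identityʳ (p d)))))

    p≥2 : ∀ d → 2 ≤ p d
    p≥2 d = prime≥2 (p-prime d)

    p>0 : ∀ d → 0 < p d
    p>0 d = ≤-trans (s≤s z≤n) (p≥2 d)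

    P>0 : ∀ d → 0 < P d
    P>0 zero    = s≤s z≤n
    P>0 (suc d) = subst (0 <_) (sym (P-suc d)) (*-mono-≤ (P>0 d) (p>0 d))

    p∤1 : ∀ d → ¬ (p d ∣ 1)
    p∤1 d pd∣1 = <-irrefl (sym (∣1⇒≡1 pd∣1)) (p≥2 d)

    p∤P : ∀ d e → e ≤ d → ¬ (p d ∣ P e)
    p∤P d zero    _   pd∣1 = p∤1 d pd∣1
    p∤P d (suc e) e<d pd∣P with euclidsLemma (P e) (p e) (p-prime d) (subst (p d ∣_) (P-suc e) pd∣P)
    ... | inj₁ pd∣Pe = p∤P d e (≤-trans (n≤1+n e) e<d) pd∣Pe
    ... | inj₂ pd∣pe with prime⇒irreducible (p-prime e) pd∣pe
    ...   | inj₁ pd≡1  = p∤1 d (subst (_∣ 1) (sym pd≡1) ∣-refl)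
    ...   | inj₂ pd≡pe = <-irrefl (sym pd≡pe) (p-increasing e d e<d)

    P⊥p : ∀ d → Coprime (P d) (p d)
    P⊥p d (i∣P , i∣p) with prime⇒irreducible (p-prime d) i∣p
    ... | inj₁ i≡1 = i≡1
    ... | inj₂ i≡p = contradiction (subst (_∣ P d) i≡p i∣P) (p∤P d d ≤-refl)

    coprime-P-pred : ∀ d {m} → Coprime (P (suc d)) m → Coprime (P d) m
    coprime-P-pred d P⊥m = coprime-∣ˡ P⊥m (subst (P d ∣_) (sym (P-suc d)) (∣m⇒∣m*n (p d) ∣-refl))

    coprime-P⇒p∤ : ∀ d {m} → Coprime (P (suc d)) m → ¬ (p d ∣ m)
    coprime-P⇒p∤ d P⊥m pd∣m = p∤1 d (subst (p d ∣_) (P⊥m (pd∣P , pd∣m)) ∣-refl)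
      where
      pd∣P : p d ∣ P (suc d)
      pd∣P = subst (p d ∣_) (sym (P-suc d)) (∣n⇒∣m*n (P d) ∣-refl)


module MoserNumbers where

  open import Defs
  open FiniteSums
  open import Data.Nat using (ℕ; zero; suc; _*_; _^_; _≤_)
  open import Data.Nat.Properties
  open import Data.Fin using (Fin; zero; suc)
  import Data.Fin.Properties as Fin
  open import Data.Vec using (Vec; []; _∷_)
  open import Data.Vec.Properties using (∷-injective; ≡-dec)
  open import Data.List using (List; []; _∷_; map; concatMap; filter; allFin; length)
  open import Data.List.Properties using (length-tabulate)
  open import Data.List.Membership.Propositional using (_∈_)
  open import Data.List.Membership.Propositional.Properties using (∈-map⁺; ∈-map⁻; ∈-filter⁻; ∈-allFin)
  open import Data.List.Relation.Unary.Any using (here)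
  open import Data.List.Relation.Unary.Unique.Propositional using (Unique)
  open import Data.List.Relation.Unary.Unique.Propositional.Properties using (allFin⁺; map⁺; filter⁺)
  open import Data.List.Relation.Unary.AllPairs using ([]; _∷_)
  open import Data.List.Relation.Unary.All using ([])
  open import Data.Product using (_,_; proj₁; proj₂)
  open import Relation.Unary using (Decidable)
  open import Relation.Nullary using (Dec)
  open import Relation.Binary.Definitions using (DecidableEquality)
  import Data.List.Membership.DecPropositional as DecMembership
  open import Relation.Binary.PropositionalEquality using (_≡_; refl; sym; trans; cong)

  module Cube (k : ℕ) where

    Point : ℕ → Set
    Point d = Vec (Fin k) d

    allPoints : (d : ℕ) → List (Point d)
    allPoints zero    = [] ∷ []
    allPoints (suc d) = concatMap (λ j → map (j ∷_) (allPoints d)) (allFin k)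

    allPoints-complete : ∀ d (v : Point d) → v ∈ allPoints d
    allPoints-complete zero    []      = here refl
    allPoints-complete (suc d) (j ∷ v) =
      ∈-concatMap-intro (λ j → map (j ∷_) (allPoints d)) (∈-allFin j) (∈-map⁺ (j ∷_) (allPoints-complete d v))

    allPoints-unique : ∀ d → Unique (allPoints d)
    allPoints-unique zero    = [] ∷ []
    allPoints-unique (suc d) =
      unique-concatMap (λ j → map (j ∷_) (allPoints d)) (allFin k) (allFin⁺ k)
        (λ _ → map⁺ (λ eq → proj₂ (∷-injective eq)) (allPoints-unique d)) heads-differ
      where
      heads-differ : ∀ {j j′ v} → j ∈ allFin k → j′ ∈ allFin k →
                     v ∈ map (j ∷_) (allPoints d) → v ∈ map (j′ ∷_) (allPoints d) → j ≡ j′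
      heads-differ _ _ v∈ v∈′ with ∈-map⁻ _ v∈ | ∈-map⁻ _ v∈′
      ... | (_ , _ , refl) | (_ , _ , eq) = proj₁ (∷-injective eq)

    sumL-allPoints-suc : ∀ d (f : Point (suc d) → ℕ) →
      sumL f (allPoints (suc d)) ≡ sumL (λ j → sumL (λ v → f (j ∷ v)) (allPoints d)) (allFin k)
    sumL-allPoints-suc d f =
      trans (sumL-concatMap f (λ j → map (j ∷_) (allPoints d)) (allFin k))
            (sumL-cong _ _ (allFin k) (λ {j} _ → sumL-map f (j ∷_) (allPoints d)))

    _≟P_ : ∀ {d} → DecidableEquality (Point d)
    _≟P_ = ≡-dec (Fin._≟_ {k})

    _∈?_ : ∀ {d} (v : Point d) (W : List (Point d)) → Dec (v ∈ W)
    v ∈? W = DecMembership._∈?_ _≟P_ v W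

    length≤count-allPoints : ∀ {d} (W : List (Point d)) → Unique W →
                             length W ≤ sumL (λ v → indicator (v ∈? W)) (allPoints d)
    length≤count-allPoints {d} W uW = length≤count _≟P_ W (allPoints d) uW (λ {v} _ → allPoints-complete d v)

    moser-zero : ∀ c → IsMoserNumber 0 k c → c ≤ 1
    moser-zero c ((W , uW , _ , |W|≡c) , _) = begin
      c                                      ≡⟨ sym |W|≡c ⟩
      length W                               ≤⟨ length≤count-allPoints W uW ⟩
      sumL (λ v → indicator (v ∈? W)) ([] ∷ []) ≤⟨ +-monoˡ-≤ 0 (indicator≤1 ([] ∈? W)) ⟩
      1                                      ∎
      where
      open ≤-Reasoning

    -- c'_{d+1,k} ≤ k c'_{d,k}: each of the k slices of a line-free set in
    -- [k]^(d+1) by the value of the first coordinate is line-free in [k]^d.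
    moser-step : ∀ {d} c₁ c₀ → IsMoserNumber (suc d) k c₁ → IsMoserNumber d k c₀ → c₁ ≤ k * c₀
    moser-step {d} c₁ c₀ ((W , uW , W-free , |W|≡c₁) , _) (_ , maximal₀) = begin
      c₁                                                               ≡⟨ sym |W|≡c₁ ⟩
      length W                                                         ≤⟨ length≤count-allPoints W uW ⟩
      sumL (λ v → indicator (v ∈? W)) (allPoints (suc d))              ≡⟨ sumL-allPoints-suc d _ ⟩
      sumL (λ j → sumL (λ v → indicator ((j ∷ v) ∈? W)) (allPoints d)) (allFin k)
                                                                       ≡⟨ sumL-cong _ _ (allFin k) (λ {j} _ → sym (length-filter≡sumL (in-slice j) (allPoints d))) ⟩
      sumL (λ j → length (slice j)) (allFin k)                         ≤⟨ sumL-mono _ (λ _ → c₀) (allFin k) (λ {j} _ → slice≤c₀ j) ⟩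
      sumL (λ _ → c₀) (allFin k)                                       ≡⟨ sumL-const c₀ (allFin k) ⟩
      length (allFin k) * c₀                                           ≡⟨ cong (_* c₀) (length-tabulate {n = k} (λ i → i)) ⟩
      k * c₀                                                           ∎
      where
      open ≤-Reasoning
      in-slice : (j : Fin k) → Decidable (λ (v : Point d) → (j ∷ v) ∈ W)
      in-slice j v = (j ∷ v) ∈? W
      slice : Fin k → List (Point d)
      slice j = filter (in-slice j) (allPoints d)
      -- A line in the slice j extends to a line in W, constant j in the first coordinate.
      extend : Fin k → (Fin d → Class k) → Fin (suc d) → Class k
      extend j s zero    = const j
      extend j s (suc i) = s i
      slice-free : ∀ j → LineFree (slice j)
      slice-free j (s , line , inSlice) = W-free (extend j s ,
        (λ t t′ eq → line t t′ (proj₂ (∷-injective eq))) ,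
        λ t → proj₂ (∈-filter⁻ (in-slice j) {xs = allPoints d} (inSlice t)))
      slice≤c₀ : ∀ j → length (slice j) ≤ c₀
      slice≤c₀ j = maximal₀ (slice j) (filter⁺ (in-slice j) (allPoints-unique d)) (slice-free j)

    moser-ratio : (c : ℕ → ℕ) → (∀ d → IsMoserNumber d k (c d)) → ∀ e → c (suc e) ≤ k * c e
    moser-ratio c isMoser e = moser-step (c (suc e)) (c e) (isMoser (suc e)) (isMoser e)

    moser≤k^d : (c : ℕ → ℕ) → (∀ d → IsMoserNumber d k (c d)) → ∀ d → c d ≤ k ^ d
    moser≤k^d c isMoser zero    = moser-zero (c 0) (isMoser 0)
    moser≤k^d c isMoser (suc d) = ≤-trans (moser-ratio c isMoser d) (*-monoʳ-≤ k (moser≤k^d c isMoser d))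


module LinesToProgressions where

  open import Defs
  open NumberTheory
  open MoserNumbers
  open import Data.Nat using (ℕ; zero; suc; _+_; _*_; _∸_; _^_; _≤_; _<_; z≤n; s≤s)
  open import Data.Nat.Properties
  open import Data.Nat.Divisibility using (_∣_; divides; ∣-refl)
  open import Data.Nat.Primality using (Prime; euclidsLemma; prime⇒irreducible)
  open import Data.Nat.Tactic.RingSolver using (solve-∀)
  open import Data.Fin using (Fin; zero; suc; toℕ; fromℕ<; opposite)
  open import Data.Fin.Properties using (toℕ-fromℕ<; opposite-prop; toℕ<n)
  open import Data.Vec using (Vec; []; _∷_)
  open import Data.List using (List; filter; length)
  open import Data.List.Membership.Propositional using (_∈_)
  open import Data.List.Membership.Propositional.Properties using (∈-filter⁻)
  open import Data.List.Membership.DecPropositional _≟_ using (_∈?_)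
  open import Data.List.Relation.Unary.Unique.Propositional.Properties using (filter⁺)
  open import Data.Product using (_,_; proj₂)
  open import Data.Sum using (_⊎_; inj₁; inj₂)
  open import Relation.Nullary using (¬_; contradiction)
  open import Relation.Binary.PropositionalEquality using (_≡_; _≢_; refl; sym; trans; cong; cong₂; subst; module ≡-Reasoning)

  -- The cube [k]^d, k ≥ 2, is embedded multiplicatively into ℕ by
  --   b · (v₀, …, v_{d-1}) ↦ b · p(d-1)^v₀ ⋯ p 0^v_{d-1}.
  -- A geometric line of the cube is mapped to a k-term geometric progression
  -- whose ratio is  ∏_{up coordinates} p / ∏_{down coordinates} p  ≠ 1.
  module Embedding (k′ : ℕ) (p : ℕ → ℕ) (p-prime : ∀ i → Prime (p i)) (p-increasing : ∀ i j → i < j → p i < p j) where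
    open Primorials p p-prime p-increasing using (p>0; p∤1)
    open Cube (suc (suc k′)) using (allPoints; allPoints-unique)

    k : ℕ
    k = suc (suc k′)

    embed : (d : ℕ) → ℕ → Vec (Fin k) d → ℕ
    embed zero    b []       = b
    embed (suc d) b (e ∷ es) = embed d (b * p d ^ toℕ e) es

    embed-* : ∀ d b x v → embed d (b * x) v ≡ embed d b v * x
    embed-* zero    b x []       = refl
    embed-* (suc d) b x (e ∷ es) =
      trans (cong (λ z → embed d z es) (x*y*z≡x*z*y b x (p d ^ toℕ e))) (embed-* d (b * p d ^ toℕ e) x es)
      where
      x*y*z≡x*z*y : ∀ a b c → a * b * c ≡ a * c * b
      x*y*z≡x*z*y = solve-∀

    -- The factor a coordinate of class c contributes to the numerator
    -- (up coordinates) and to the denominator (down coordinates) of the ratio.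
    upFactor downFactor : Class k → ℕ → ℕ
    upFactor up        x = x
    upFactor (const _) x = 1
    upFactor down      x = 1
    downFactor down      x = x
    downFactor (const _) x = 1
    downFactor up        x = 1

    IsFactor : (Class k → ℕ → ℕ) → Set
    IsFactor g = ∀ c x → g c x ≡ x ⊎ g c x ≡ 1

    upFactor-isFactor : IsFactor upFactor
    upFactor-isFactor up        x = inj₁ refl
    upFactor-isFactor (const _) x = inj₂ refl
    upFactor-isFactor down      x = inj₂ refl

    downFactor-isFactor : IsFactor downFactor
    downFactor-isFactor down      x = inj₁ refl
    downFactor-isFactor (const _) x = inj₂ refl
    downFactor-isFactor up        x = inj₂ refl

    ratioPart : (Class k → ℕ → ℕ) → (d : ℕ) → (Fin d → Class k) → ℕ
    ratioPart g zero    s = 1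
    ratioPart g (suc d) s = g (s zero) (p d) * ratioPart g d (λ i → s (suc i))

    ratioPart>0 : ∀ g → IsFactor g → ∀ d s → 0 < ratioPart g d s
    ratioPart>0 g g-factor zero    s = s≤s z≤n
    ratioPart>0 g g-factor (suc d) s = *-mono-≤ g>0 (ratioPart>0 g g-factor d (λ i → s (suc i)))
      where
      g>0 : 0 < g (s zero) (p d)
      g>0 with g-factor (s zero) (p d)
      ... | inj₁ eq = subst (0 <_) (sym eq) (p>0 d)
      ... | inj₂ eq = subst (0 <_) (sym eq) (s≤s z≤n)

    p∤ratioPart : ∀ g → IsFactor g → ∀ d e s → e ≤ d → ¬ (p d ∣ ratioPart g e s)
    p∤ratioPart g g-factor d zero    s _   pd∣1 = p∤1 d pd∣1
    p∤ratioPart g g-factor d (suc e) s e<d pd∣ with euclidsLemma (g (s zero) (p e)) _ (p-prime d) pd∣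
    ... | inj₂ pd∣rest = p∤ratioPart g g-factor d e (λ i → s (suc i)) (≤-trans (n≤1+n e) e<d) pd∣rest
    ... | inj₁ pd∣g with g-factor (s zero) (p e)
    ...   | inj₂ g≡1 = p∤1 d (subst (p d ∣_) g≡1 pd∣g)
    ...   | inj₁ g≡pe with prime⇒irreducible (p-prime e) (subst (p d ∣_) g≡pe pd∣g)
    ...     | inj₁ pd≡1  = p∤1 d (subst (_∣ 1) (sym pd≡1) ∣-refl)
    ...     | inj₂ pd≡pe = <-irrefl (sym pd≡pe) (p-increasing e d e<d)

    numerator denominator : (d : ℕ) → (Fin d → Class k) → ℕ
    numerator   = ratioPart upFactor
    denominator = ratioPart downFactor

    coordinate-identity : ∀ (c : Class k) (q : ℕ) (j : Fin k) →
      q ^ toℕ (classVal c j) * downFactor c q ^ toℕ j ≡ q ^ toℕ (classVal c zero) * upFactor c q ^ toℕ j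
    coordinate-identity (const c) q j = refl
    coordinate-identity up        q j =
      trans (cong (q ^ toℕ j *_) (^-zeroˡ (toℕ j))) (trans (*-identityʳ _) (sym (+-identityʳ _)))
    coordinate-identity down      q j = begin
      q ^ toℕ (opposite j) * q ^ toℕ j  ≡⟨ sym (^-distribˡ-+-* q (toℕ (opposite j)) (toℕ j)) ⟩
      q ^ (toℕ (opposite j) + toℕ j)    ≡⟨ cong (q ^_) opposite+j ⟩
      q ^ toℕ (opposite {k} zero)       ≡⟨ sym (*-identityʳ _) ⟩
      q ^ toℕ (opposite {k} zero) * 1   ≡⟨ cong (q ^ toℕ (opposite {k} zero) *_) (sym (^-zeroˡ (toℕ j))) ⟩
      q ^ toℕ (opposite {k} zero) * 1 ^ toℕ j ∎
      where
      open ≡-Reasoning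
      opposite+j : toℕ (opposite j) + toℕ j ≡ toℕ (opposite {k} zero)
      opposite+j rewrite opposite-prop j | opposite-prop {k} zero = m∸n+n≡m (≤-pred (toℕ<n j))

    line-ratio : ∀ d b (s : Fin d → Class k) (j : Fin k) →
      embed d b (linePoint s j) * denominator d s ^ toℕ j ≡ embed d b (linePoint s zero) * numerator d s ^ toℕ j
    line-ratio zero    b s j = cong (b *_) (trans (^-zeroˡ (toℕ j)) (sym (^-zeroˡ (toℕ j))))
    line-ratio (suc d) b s j = begin
      embed d (b * X) (linePoint s′ j) * (w * W) ^ toℕ j         ≡⟨ cong₂ _*_ (embed-* d b X (linePoint s′ j)) (^-distribʳ-* w W (toℕ j)) ⟩
      embed d b (linePoint s′ j) * X * (w ^ toℕ j * W ^ toℕ j) ≡⟨ rearrange (embed d b (linePoint s′ j)) X (w ^ toℕ j) (W ^ toℕ j) ⟩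
      embed d b (linePoint s′ j) * W ^ toℕ j * (X * w ^ toℕ j)  ≡⟨ cong₂ _*_ (line-ratio d b s′ j) (coordinate-identity (s zero) (p d) j) ⟩
      embed d b (linePoint s′ zero) * U ^ toℕ j * (X₀ * u ^ toℕ j) ≡⟨ sym (rearrange (embed d b (linePoint s′ zero)) X₀ (u ^ toℕ j) (U ^ toℕ j)) ⟩
      embed d b (linePoint s′ zero) * X₀ * (u ^ toℕ j * U ^ toℕ j) ≡⟨ sym (cong₂ _*_ (embed-* d b X₀ (linePoint s′ zero)) (^-distribʳ-* u U (toℕ j))) ⟩
      embed d (b * X₀) (linePoint s′ zero) * (u * U) ^ toℕ j     ∎
      where
      open ≡-Reasoning
      s′ = λ i → s (suc i)
      X  = p d ^ toℕ (classVal (s zero) j)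
      X₀ = p d ^ toℕ (classVal (s zero) zero)
      u  = upFactor (s zero) (p d)
      w  = downFactor (s zero) (p d)
      U  = numerator d s′
      W  = denominator d s′
      rearrange : ∀ a b c d → a * b * (c * d) ≡ a * d * (b * c)
      rearrange = solve-∀

    ratio≡1⇒degenerate : ∀ d (s : Fin d → Class k) → numerator d s ≡ denominator d s →
                         ∀ j j′ → linePoint s j ≡ linePoint s j′
    ratio≡1⇒degenerate zero    s eq j j′ = refl
    ratio≡1⇒degenerate (suc d) s eq j j′ = first-coordinate (s zero) eq
      where
      s′ = λ i → s (suc i)
      first-coordinate : ∀ c → upFactor c (p d) * numerator d s′ ≡ downFactor c (p d) * denominator d s′ →
        _≡_ {A = Vec (Fin k) (suc d)} (classVal c j ∷ linePoint s′ j) (classVal c j′ ∷ linePoint s′ j′)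
      first-coordinate (const c) eq′ =
        cong (c ∷_) (ratio≡1⇒degenerate d s′ (trans (sym (+-identityʳ _)) (trans eq′ (+-identityʳ _))) j j′)
      first-coordinate up   eq′ = contradiction
        (divides (numerator d s′) (trans (sym (+-identityʳ _)) (trans (sym eq′) (*-comm (p d) _))))
        (p∤ratioPart downFactor downFactor-isFactor d d s′ ≤-refl)
      first-coordinate down eq′ = contradiction
        (divides (denominator d s′) (trans (sym (+-identityʳ _)) (trans eq′ (*-comm (p d) _))))
        (p∤ratioPart upFactor upFactor-isFactor d d s′ ≤-refl)

    line⇒progression : ∀ (A : List ℕ) d b (s : Fin d → Class k) → IsGeomLine s →
                       (∀ j → embed d b (linePoint s j) ∈ A) → ContainsGP k A
    line⇒progression A d b s line inA =
      embed d b (linePoint s zero) , numerator d s , denominator d s ,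
      ratioPart>0 upFactor upFactor-isFactor d s , ratioPart>0 downFactor downFactor-isFactor d s ,
      (λ eq → 0≢1 (line zero (suc zero) (ratio≡1⇒degenerate d s eq zero (suc zero)))) ,
      λ i i<k → embed d b (linePoint s (fromℕ< i<k)) , inA (fromℕ< i<k) ,
        subst (λ t → embed d b (linePoint s (fromℕ< i<k)) * denominator d s ^ t ≡ embed d b (linePoint s zero) * numerator d s ^ t)
              (toℕ-fromℕ< i<k) (line-ratio d b s (fromℕ< i<k))
      where
      0≢1 : zero ≢ suc {suc k′} zero
      0≢1 ()

    fibre : List ℕ → (d : ℕ) → ℕ → List (Vec (Fin k) d)
    fibre A d b = filter (λ v → embed d b v ∈? A) (allPoints d)

    -- If A is GP_k-free then every fibre is line-free, hence has at most
    -- c'_{d,k} points.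
    fibre≤moser : ∀ (A : List ℕ) → ¬ ContainsGP k A → ∀ d b c → IsMoserNumber d k c → length (fibre A d b) ≤ c
    fibre≤moser A A-free d b c (_ , maximal) =
      maximal (fibre A d b) (filter⁺ (λ v → embed d b v ∈? A) (allPoints-unique d)) fibre-lineFree
      where
      fibre-lineFree : LineFree (fibre A d b)
      fibre-lineFree (s , line , inFibre) = A-free (line⇒progression A d b s line
        (λ j → proj₂ (∈-filter⁻ (λ v → embed d b v ∈? A) {xs = allPoints d} (inFibre j))))


module Totients where

  open import Defs using (φ)
  open FiniteSums
  open import Data.Nat using (ℕ; zero; suc; _+_; _*_)
  open import Data.Nat.Properties using (+-identityʳ; +-suc; +-assoc)
  open import Data.Nat.Divisibility using (∣m∣n⇒∣m+n; ∣m+n∣m⇒∣n)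
  open import Data.Nat.Coprimality using (coprime?)
  open import Data.List using ([]; _∷_; map; upTo; filter; length)
  open import Data.List.Properties using (upTo-∷ʳ; map-++)
  open import Data.Product using (_,_)
  open import Relation.Nullary using (yes; no; contradiction)
  open import Relation.Binary.PropositionalEquality using (_≡_; refl; sym; trans; cong; cong₂; module ≡-Reasoning)

  sumInterval : (ℕ → ℕ) → ℕ → ℕ
  sumInterval g a = sumL g (interval a)

  sumInterval-suc : ∀ g a → sumInterval g (suc a) ≡ sumInterval g a + g (suc a)
  sumInterval-suc g a = begin
    sumL g (map suc (upTo (suc a)))                ≡⟨ cong (λ xs → sumL g (map suc xs)) (sym (upTo-∷ʳ a)) ⟩
    sumL g (map suc (upTo a ++ a ∷ []))            ≡⟨ cong (sumL g) (map-++ suc (upTo a) (a ∷ [])) ⟩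
    sumL g (interval a ++ suc a ∷ [])              ≡⟨ sumL-++ g (interval a) (suc a ∷ []) ⟩
    sumInterval g a + (g (suc a) + 0)              ≡⟨ cong (sumInterval g a +_) (+-identityʳ (g (suc a))) ⟩
    sumInterval g a + g (suc a)                    ∎
    where
    open ≡-Reasoning
    open Data.List using (_++_)

  sumInterval-+ : ∀ g x y → sumInterval g (x + y) ≡ sumInterval g x + sumInterval (λ i → g (x + i)) y
  sumInterval-+ g x zero    = trans (cong (sumInterval g) (+-identityʳ x)) (sym (+-identityʳ _))
  sumInterval-+ g x (suc y) = begin
    sumInterval g (x + suc y)                                            ≡⟨ cong (sumInterval g) (+-suc x y) ⟩
    sumInterval g (suc (x + y))                                          ≡⟨ sumInterval-suc g (x + y) ⟩
    sumInterval g (x + y) + g (suc (x + y))                              ≡⟨ cong₂ _+_ (sumInterval-+ g x y) (cong g (sym (+-suc x y))) ⟩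
    sumInterval g x + sumInterval (λ i → g (x + i)) y + g (x + suc y)    ≡⟨ +-assoc (sumInterval g x) _ _ ⟩
    sumInterval g x + (sumInterval (λ i → g (x + i)) y + g (x + suc y))  ≡⟨ cong (sumInterval g x +_) (sym (sumInterval-suc (λ i → g (x + i)) y)) ⟩
    sumInterval g x + sumInterval (λ i → g (x + i)) (suc y)              ∎
    where open ≡-Reasoning

  -- Coprimality to Q is periodic modulo Q, so exactly a φ(Q) of the numbers
  -- 1, …, a Q are coprime to Q.
  coprimeCount-periodic : ∀ Q a → length (filter (coprime? Q) (interval (a * Q))) ≡ a * φ Q
  coprimeCount-periodic Q a = trans (length-filter≡sumL (coprime? Q) (interval (a * Q))) (periodic a)
    where
    coprime-to : ℕ → ℕ
    coprime-to x = indicator (coprime? Q x)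

    shift-invariant : ∀ i → coprime-to (Q + i) ≡ coprime-to i
    shift-invariant i with coprime? Q (Q + i) | coprime? Q i
    ... | yes _    | yes _    = refl
    ... | no ¬Q⊥Qi | yes Q⊥i  = contradiction (λ {d} (d∣Q , d∣Qi) → Q⊥i (d∣Q , ∣m+n∣m⇒∣n d∣Qi d∣Q)) ¬Q⊥Qi
    ... | yes Q⊥Qi | no ¬Q⊥i  = contradiction (λ {d} (d∣Q , d∣i) → Q⊥Qi (d∣Q , ∣m∣n⇒∣m+n d∣Q d∣i)) ¬Q⊥i
    ... | no _     | no _     = refl

    periodic : ∀ a → sumInterval coprime-to (a * Q) ≡ a * φ Q
    periodic zero    = refl
    periodic (suc a) = begin
      sumInterval coprime-to (Q + a * Q)                                  ≡⟨ sumInterval-+ coprime-to Q (a * Q) ⟩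
      sumInterval coprime-to Q + sumInterval (λ i → coprime-to (Q + i)) (a * Q)
                       ≡⟨ cong₂ _+_ (sym (length-filter≡sumL (coprime? Q) (interval Q)))
                                    (sumL-cong _ _ (interval (a * Q)) (λ {i} _ → shift-invariant i)) ⟩
      φ Q + sumInterval coprime-to (a * Q)                                ≡⟨ cong (φ Q +_) (periodic a) ⟩
      φ Q + a * φ Q                                                       ∎
      where open ≡-Reasoning


module CubePacking where

  open import Defs
  open FiniteSums
  open NumberTheory
  open MoserNumbers
  open LinesToProgressions
  open Totients
  open import Data.Nat using (ℕ; zero; suc; _+_; _*_; _∸_; _^_; _≤_; _<_; _≤?_)
  open import Data.Nat.Properties
  open import Data.Nat.Coprimality using (Coprime; coprime?)
  open import Data.Nat.Primality using (Prime)
  open import Data.Nat.Tactic.RingSolver using (solve-∀)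
  open import Data.Fin using (Fin; toℕ)
  open import Data.Fin.Properties using (toℕ<n; toℕ-injective)
  open import Data.Nat.Divisibility using (_∣_)
  open import Data.Vec using (_∷_)
  open import Data.List using (List; map; concatMap; filter; length; upTo; allFin)
  open import Data.List.Properties using (length-map; length-tabulate)
  open import Data.List.Membership.Propositional using (_∈_)
  open import Data.List.Membership.Propositional.Properties using (∈-map⁺; ∈-map⁻; ∈-filter⁻; ∈-filter⁺; ∈-upTo⁺; ∈-upTo⁻)
  open import Data.List.Relation.Unary.Unique.Propositional using (Unique)
  open import Data.List.Relation.Unary.Unique.Propositional.Properties using (filter⁺; map⁺; upTo⁺; allFin⁺)
  open import Data.Product using (_×_; _,_; proj₁; proj₂)
  open import Data.Product.Properties using (,-injectiveˡ; ,-injectiveʳ)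
  import Data.Product.Properties as Product
  open import Relation.Nullary using (¬_; Dec; yes; no)
  open import Relation.Nullary.Decidable using (_×-dec_)
  open import Relation.Binary.Definitions using (DecidableEquality)
  open import Relation.Binary.PropositionalEquality using (_≡_; refl; sym; trans; cong; cong₂; subst; module ≡-Reasoning)

  -- A cube of level d is indexed by (t , m) with
  -- t < T and m coprime to P d; its points are the images of [k]^d under the
  -- embedding with base point  m · p0^(t k)  (p0 = 2 in the application), and
  -- it is admissible if all of them are ≤ n.  A cube of level e + 1 is the disjoint union of k cubes of
  -- level e (its "children"), obtained by fixing the exponent of the prime p e
  -- (for e = 0: the exponent t k + j of p0, j < k).
  module Cubes (k′ : ℕ) (p : ℕ → ℕ) (p-prime : ∀ i → Prime (p i)) (p-increasing : ∀ i j → i < j → p i < p j)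
               (n T : ℕ) where
    open Embedding k′ p p-prime p-increasing using (k)
    open Primorials p p-prime p-increasing

    Index : Set
    Index = ℕ × ℕ

    _≟I_ : DecidableEquality Index
    _≟I_ = Product.≡-dec _≟_ _≟_

    base : Index → ℕ
    base (t , m) = m * p 0 ^ (t * k)

    Admissible : ℕ → Index → Set
    Admissible d (t , m) = Coprime (P d) m × base (t , m) * P d ^ suc k′ ≤ n

    admissible? : ∀ d g → Dec (Admissible d g)
    admissible? d (t , m) = coprime? (P d) m ×-dec (base (t , m) * P d ^ suc k′ ≤? n)

    indices : List Index
    indices = concatMap (λ t → map (t ,_) (interval n)) (upTo T)

    ∈-indices⁺ : ∀ {t m} → t < T → m ∈ interval n → (t , m) ∈ indices
    ∈-indices⁺ {t} t<T m∈ = ∈-concatMap-intro (λ t → map (t ,_) (interval n)) (∈-upTo⁺ t<T) (∈-map⁺ (t ,_) m∈)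

    ∈-indices⁻ : ∀ {t m} → (t , m) ∈ indices → t < T × m ∈ interval n
    ∈-indices⁻ g∈ with ∈-concatMap-elim (λ t → map (t ,_) (interval n)) (upTo T) g∈
    ... | (t , t∈ , g∈′) with ∈-map⁻ (t ,_) g∈′
    ...   | (_ , m∈ , refl) = ∈-upTo⁻ t∈ , m∈

    indices-unique : Unique indices
    indices-unique = unique-concatMap (λ t → map (t ,_) (interval n)) (upTo T) (upTo⁺ T)
      (λ _ → map⁺ ,-injectiveʳ (interval-unique n)) first-components-differ
      where
      first-components-differ : ∀ {t t′ g} → t ∈ upTo T → t′ ∈ upTo T →
        g ∈ map (t ,_) (interval n) → g ∈ map (t′ ,_) (interval n) → t ≡ t′
      first-components-differ {t} {t′} _ _ g∈ g∈′ with ∈-map⁻ (t ,_) g∈ | ∈-map⁻ (t′ ,_) g∈′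
      ... | (_ , _ , refl) | (_ , _ , eq) = ,-injectiveˡ eq

    layer : ℕ → List Index
    layer zero    = map (0 ,_) (interval n)
    layer (suc e) = filter (admissible? (suc e)) indices

    layer-unique : ∀ d → Unique (layer d)
    layer-unique zero    = map⁺ ,-injectiveʳ (interval-unique n)
    layer-unique (suc e) = filter⁺ (admissible? (suc e)) indices-unique

    base-zero : ∀ x → base (0 , x) ≡ x
    base-zero x = *-identityʳ x

    child : ℕ → Index → Fin k → Index
    child zero    g       j = (0 , base g * p 0 ^ toℕ j)
    child (suc e) (t , m) j = (t , m * p (suc e) ^ toℕ j)

    base-child : ∀ e g j → base (child e g j) ≡ base g * p e ^ toℕ j
    base-child zero    (t , m) j = base-zero _
    base-child (suc e) (t , m) j = x*y*z≡x*z*y m (p (suc e) ^ toℕ j) (p 0 ^ (t * k))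
      where
      x*y*z≡x*z*y : ∀ a b c → a * b * c ≡ a * c * b
      x*y*z≡x*z*y = solve-∀

    private
      toℕ≤k-1 : (j : Fin k) → toℕ j ≤ suc k′
      toℕ≤k-1 j = ≤-pred (toℕ<n j)

      -- The exponents used by a child stay below k, so the child of an
      -- admissible cube still lies in [n].
      p^j≤ : ∀ q → 0 < q → (j : Fin k) → q ^ toℕ j ≤ q ^ suc k′
      p^j≤ (suc q) _ j = ^-monoʳ-≤ (suc q) (toℕ≤k-1 j)

      layer⁻ : ∀ e {g} → g ∈ layer (suc e) → g ∈ indices × Admissible (suc e) g
      layer⁻ e g∈ = ∈-filter⁻ (admissible? (suc e)) {xs = indices} g∈

    child∈layer : ∀ e {g} → g ∈ layer (suc e) → (j : Fin k) → child e g j ∈ layer e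
    child∈layer zero {t , m} g∈ j with layer⁻ zero g∈
    ... | (g∈indices , (_ , size)) = ∈-map⁺ (0 ,_) (∈-interval⁺ positive bounded)
      where
      m>0 = proj₁ (∈-interval⁻ (proj₂ (∈-indices⁻ g∈indices)))
      positive = *-mono-≤ (*-mono-≤ m>0 (^>0 (p>0 0) (t * k))) (^>0 (p>0 0) (toℕ j))
      bounded = ≤-trans (*-monoʳ-≤ (base (t , m)) (p^j≤ (p 0) (p>0 0) j))
                        (subst (λ z → base (t , m) * z ^ suc k′ ≤ n) (*-identityʳ (p 0)) size)
    child∈layer (suc e) {t , m} g∈ j with layer⁻ (suc e) g∈
    ... | (g∈indices , (P⊥m , size)) =
      ∈-filter⁺ (admissible? (suc e)) (∈-indices⁺ (proj₁ (∈-indices⁻ g∈indices)) (∈-interval⁺ positive bounded))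
                (coprime , size′)
      where
      q = p (suc e)
      Q = P (suc e)
      m>0 = proj₁ (∈-interval⁻ (proj₂ (∈-indices⁻ g∈indices)))
      coprime : Coprime Q (m * q ^ toℕ j)
      coprime = coprime-* (coprime-P-pred (suc e) P⊥m) (coprime-^ (toℕ j) (P⊥p (suc e)))
      size′ : base (t , m * q ^ toℕ j) * Q ^ suc k′ ≤ n
      size′ = begin
        base (t , m * q ^ toℕ j) * Q ^ suc k′    ≡⟨ cong (_* Q ^ suc k′) (base-child (suc e) (t , m) j) ⟩
        base (t , m) * q ^ toℕ j * Q ^ suc k′    ≤⟨ *-monoˡ-≤ (Q ^ suc k′) (*-monoʳ-≤ (base (t , m)) (p^j≤ q (p>0 (suc e)) j)) ⟩
        base (t , m) * q ^ suc k′ * Q ^ suc k′   ≡⟨ *-assoc (base (t , m)) _ _ ⟩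
        base (t , m) * (q ^ suc k′ * Q ^ suc k′) ≡⟨ cong (base (t , m) *_) (sym (^-distribʳ-* q Q (suc k′))) ⟩
        base (t , m) * (q * Q) ^ suc k′          ≡⟨ cong (λ z → base (t , m) * z ^ suc k′) (trans (*-comm q Q) (sym (P-suc (suc e)))) ⟩
        base (t , m) * P (suc (suc e)) ^ suc k′  ≤⟨ size ⟩
        n                                        ∎
        where open ≤-Reasoning
      positive = *-mono-≤ m>0 (^>0 (p>0 (suc e)) (toℕ j))
      bounded = ≤-trans (≤*pos (m * q ^ toℕ j) (^>0 (p>0 0) (t * k)))
                  (≤-trans (≤*pos (m * q ^ toℕ j * p 0 ^ (t * k)) (^>0 (P>0 (suc e)) (suc k′))) size′)

    -- Distinct children (of the same or of distinct cubes) are distinct: this is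
    -- where the coprimality condition and unique factorisation enter.
    child-injective : ∀ e {g g′} → g ∈ layer (suc e) → g′ ∈ layer (suc e) → ∀ j j′ →
                      child e g j ≡ child e g′ j′ → g ≡ g′ × j ≡ j′
    child-injective zero {t , m} {t′ , m′} g∈ g′∈ j j′ eq
      with prime-power-cancel (p 0) (p-prime 0) m m′ (odd g∈) (odd g′∈) (t * k + toℕ j) (t′ * k + toℕ j′)
             (trans (merge m t j) (trans (,-injectiveʳ eq) (sym (merge m′ t′ j′))))
      where
      odd : ∀ {g} → g ∈ layer 1 → ¬ (p 0 ∣ proj₂ g)
      odd g∈ = coprime-P⇒p∤ 0 (proj₁ (proj₂ (layer⁻ zero g∈)))
      merge : ∀ m t (j : Fin k) → m * p 0 ^ (t * k + toℕ j) ≡ m * p 0 ^ (t * k) * p 0 ^ toℕ j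
      merge m t j = trans (cong (m *_) (^-distribˡ-+-* (p 0) (t * k) (toℕ j))) (sym (*-assoc m _ _))
    ... | (exponents≡ , m≡m′) with divmod-unique k (toℕ<n j) (toℕ<n j′) exponents≡
    ...   | (t≡t′ , j≡j′) = cong₂ _,_ t≡t′ m≡m′ , toℕ-injective j≡j′
    child-injective (suc e) {t , m} {t′ , m′} g∈ g′∈ j j′ eq
      with prime-power-cancel (p (suc e)) (p-prime (suc e)) m m′ (p∤ g∈) (p∤ g′∈) (toℕ j) (toℕ j′) (,-injectiveʳ eq)
      where
      p∤ : ∀ {g} → g ∈ layer (suc (suc e)) → ¬ (p (suc e) ∣ proj₂ g)
      p∤ g∈ = coprime-P⇒p∤ (suc e) (proj₁ (proj₂ (layer⁻ (suc e) g∈)))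
    ... | (j≡j′ , m≡m′) = cong₂ _,_ (,-injectiveˡ eq) m≡m′ , toℕ-injective j≡j′

    childrenOf : ℕ → Index → List Index
    childrenOf e g = map (child e g) (allFin k)

    children : ℕ → List Index
    children e = concatMap (childrenOf e) (layer (suc e))

    children-unique : ∀ e → Unique (children e)
    children-unique e = unique-concatMap (childrenOf e) (layer (suc e)) (layer-unique (suc e))
      (λ g∈ → unique-map (child e _) (allFin k) (allFin⁺ k) (λ {j} {j′} _ _ eq → proj₂ (child-injective e g∈ g∈ j j′ eq)))
      distinct-parents
      where
      distinct-parents : ∀ {g g′ h} → g ∈ layer (suc e) → g′ ∈ layer (suc e) →
                         h ∈ childrenOf e g → h ∈ childrenOf e g′ → g ≡ g′
      distinct-parents {g} {g′} g∈ g′∈ h∈ h∈′ with ∈-map⁻ (child e g) h∈ | ∈-map⁻ (child e g′) h∈′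
      ... | (j , _ , refl) | (j′ , _ , eq) = proj₁ (child-injective e g∈ g′∈ j j′ eq)

    children⊆layer : ∀ e {h} → h ∈ children e → h ∈ layer e
    children⊆layer e h∈ with ∈-concatMap-elim (childrenOf e) (layer (suc e)) h∈
    ... | (g , g∈ , h∈′) with ∈-map⁻ (child e g) h∈′
    ...   | (j , _ , refl) = child∈layer e g∈ j

    module Deficiency (A : List ℕ) (A-unique : Unique A) (A⊆[n] : ∀ x → x ∈ A → InRange n x)
                      (A-free : ¬ ContainsGP k A) (c : ℕ → ℕ) (isMoser : ∀ d → IsMoserNumber d k (c d)) where
      open Embedding k′ p p-prime p-increasing using (fibre; fibre≤moser)
      open Cube k using (allPoints; sumL-allPoints-suc)
      open import Data.List.Membership.DecPropositional _≟_ using (_∈?_)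

      count : ℕ → ℕ → ℕ
      count d b = length (fibre A d b)

      count≤moser : ∀ d b → count d b ≤ c d
      count≤moser d b = fibre≤moser A A-free d b (c d) (isMoser d)

      count-zero : ∀ x → count 0 x ≡ indicator (x ∈? A)
      count-zero x with x ∈? A
      ... | yes _ = refl
      ... | no _  = refl

      count-suc : ∀ e b → count (suc e) b ≡ sumL (λ j → count e (b * p e ^ toℕ j)) (allFin k)
      count-suc e b = begin
        count (suc e) b                                                        ≡⟨ length-filter≡sumL _ (allPoints (suc e)) ⟩
        sumL (λ v → indicator (embed-in-A v)) (allPoints (suc e))              ≡⟨ sumL-allPoints-suc e _ ⟩
        sumL (λ j → sumL (λ v → indicator (embed-in-A (j ∷ v))) (allPoints e)) (allFin k)
                                     ≡⟨ sumL-cong _ _ (allFin k) (λ _ → sym (length-filter≡sumL _ (allPoints e))) ⟩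
        sumL (λ j → count e (b * p e ^ toℕ j)) (allFin k)                      ∎
        where
        open ≡-Reasoning
        open Embedding k′ p p-prime p-increasing using (embed)
        embed-in-A : ∀ v → Dec (embed (suc e) b v ∈ A)
        embed-in-A v = embed (suc e) b v ∈? A

      deficiency : ℕ → ℕ
      deficiency d = sumL (λ g → c d ∸ count d (base g)) (layer d)

      weight : ℕ → ℕ
      weight e = k * c e ∸ c (suc e)

      -- Passing from level e + 1 to level e, every cube of level e + 1 loses at
      -- least  weight e  more points:
      --   N_{e+1} (k c_e - c_{e+1}) + deficiency (e + 1) ≤ deficiency e.
      deficiency-step : ∀ e → length (layer (suc e)) * weight e + deficiency (suc e) ≤ deficiency e
      deficiency-step e = begin
        length (layer (suc e)) * weight e + deficiency (suc e)
          ≡⟨ cong (_+ deficiency (suc e)) (sym (sumL-const (weight e) (layer (suc e)))) ⟩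
        sumL (λ _ → weight e) (layer (suc e)) + deficiency (suc e)
          ≡⟨ sym (sumL-+ _ _ (layer (suc e))) ⟩
        sumL (λ g → weight e + (c (suc e) ∸ count (suc e) (base g))) (layer (suc e))
          ≡⟨ sumL-cong _ _ (layer (suc e)) (λ {g} _ → per-cube g) ⟩
        sumL (λ g → sumL (λ h → missing h) (childrenOf e g)) (layer (suc e))
          ≡⟨ sym (sumL-concatMap missing (childrenOf e) (layer (suc e))) ⟩
        sumL missing (children e)
          ≤⟨ sumL-⊆ (_≟I_) missing (children e) (layer e) (children-unique e) (children⊆layer e) ⟩
        deficiency e ∎
        where
        open ≤-Reasoning
        missing : Index → ℕ
        missing h = c e ∸ count e (base h)
        ∸-split : ∀ {a m x} → x ≤ m → m ≤ a → (a ∸ m) + (m ∸ x) ≡ a ∸ x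
        ∸-split {a} {m} {x} x≤m m≤a =
          trans (sym (+-∸-assoc (a ∸ m) x≤m)) (cong (_∸ x) (m∸n+n≡m m≤a))
        per-cube : ∀ g → weight e + (c (suc e) ∸ count (suc e) (base g)) ≡ sumL missing (childrenOf e g)
        per-cube g = sym (begin-equality
          sumL missing (childrenOf e g)
            ≡⟨ sumL-map missing (child e g) (allFin k) ⟩
          sumL (λ j → c e ∸ count e (base (child e g j))) (allFin k)
            ≡⟨ sumL-cong _ _ (allFin k) (λ {j} _ → cong (λ b → c e ∸ count e b) (base-child e g j)) ⟩
          sumL (λ j → c e ∸ count e (base g * p e ^ toℕ j)) (allFin k)
            ≡⟨ sumL-complement (c e) _ (allFin k) (λ _ → count≤moser e _) ⟩
          length (allFin k) * c e ∸ sumL (λ j → count e (base g * p e ^ toℕ j)) (allFin k)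
            ≡⟨ cong₂ (λ l s → l * c e ∸ s) (length-tabulate {n = k} (λ i → i)) (sym (count-suc e (base g))) ⟩
          k * c e ∸ count (suc e) (base g)
            ≡⟨ sym (∸-split (count≤moser (suc e) (base g)) (Cube.moser-ratio k c isMoser e)) ⟩
          weight e + (c (suc e) ∸ count (suc e) (base g)) ∎)

      -- At level 0 the cubes are the points of [n] and c'_{0,k} ≤ 1, so the
      -- deficiency counts (at most) the points of [n] outside A.
      deficiency-zero : length A + deficiency 0 ≤ n
      deficiency-zero = begin
        length A + deficiency 0                                  ≤⟨ +-monoˡ-≤ (deficiency 0) |A|≤ ⟩
        sumL in-A (interval n) + deficiency 0                    ≡⟨ cong (_+ deficiency 0) (sumL-cong _ _ (interval n) (λ {x} _ → sym (count-zero x))) ⟩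
        sumL (λ x → count 0 x) (interval n) + deficiency 0       ≡⟨ +-comm _ (deficiency 0) ⟩
        deficiency 0 + sumL (λ x → count 0 x) (interval n)       ≡⟨ cong (_+ sumL (λ x → count 0 x) (interval n)) level-zero ⟩
        sumL (λ x → c 0 ∸ count 0 x) (interval n) + sumL (λ x → count 0 x) (interval n)
                                                                 ≡⟨ sumL-complement+sumL (c 0) _ (interval n) (λ _ → count≤moser 0 _) ⟩
        length (interval n) * c 0                                ≤⟨ *-monoʳ-≤ (length (interval n)) (Cube.moser-zero k (c 0) (isMoser 0)) ⟩
        length (interval n) * 1                                  ≡⟨ trans (*-identityʳ _) (length-interval n) ⟩
        n                                                        ∎
        where
        open ≤-Reasoning
        in-A : ℕ → ℕ
        in-A x = indicator (x ∈? A)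
        level-zero : deficiency 0 ≡ sumL (λ x → c 0 ∸ count 0 x) (interval n)
        level-zero = trans (sumL-map (λ g → c 0 ∸ count 0 (base g)) (0 ,_) (interval n))
                           (sumL-cong _ _ (interval n) (λ {x} _ → cong (λ b → c 0 ∸ count 0 b) (base-zero x)))
        |A|≤ : length A ≤ sumL in-A (interval n)
        |A|≤ = length≤count _≟_ A (interval n) A-unique (λ {x} x∈A → ∈-interval⁺ (proj₁ (A⊆[n] x x∈A)) (proj₂ (A⊆[n] x x∈A)))

      packing : ∀ D → length A + sumBelow D (λ e → length (layer (suc e)) * weight e) ≤ n
      packing D = ≤-trans (m≤m+n _ (deficiency D)) (with-deficiency D)
        where
        with-deficiency : ∀ D → length A + sumBelow D (λ e → length (layer (suc e)) * weight e) + deficiency D ≤ n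
        with-deficiency zero    = ≤-trans (≤-reflexive (cong (_+ deficiency 0) (+-identityʳ (length A)))) deficiency-zero
        with-deficiency (suc D) = begin
          length A + (S + W) + deficiency (suc D)   ≡⟨ trans (cong (_+ deficiency (suc D)) (sym (+-assoc (length A) S W))) (+-assoc (length A + S) W (deficiency (suc D))) ⟩
          length A + S + (W + deficiency (suc D))   ≤⟨ +-monoʳ-≤ (length A + S) (deficiency-step D) ⟩
          length A + S + deficiency D               ≤⟨ with-deficiency D ⟩
          n                                         ∎
          where
          open ≤-Reasoning
          S = sumBelow D (λ e → length (layer (suc e)) * weight e)
          W = length (layer (suc D)) * weight D

    -- Lower bound on the number of cubes of level e + 1.  Let P = P (e + 1) and
    -- suppose a t copies of p0^(t k) P^k fit into n.  The indices (t , m) with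
    -- t < T, m ≤ a t P and m coprime to P are admissible; they number
    -- Σ_t a t φ(P) by the periodicity of coprimality.
    module CoprimeCubes (e : ℕ) (a : ℕ → ℕ) where

      Q : ℕ
      Q = P (suc e)

      block : ℕ → List Index
      block t = map (t ,_) (filter (coprime? Q) (interval (a t * Q)))

      coprimeCubes : List Index
      coprimeCubes = concatMap block (upTo T)

      coprimeCubes-unique : Unique coprimeCubes
      coprimeCubes-unique = unique-concatMap block (upTo T) (upTo⁺ T)
        (λ {t} _ → map⁺ ,-injectiveʳ (filter⁺ (coprime? Q) (interval-unique (a t * Q)))) distinct-blocks
        where
        distinct-blocks : ∀ {t t′ g} → t ∈ upTo T → t′ ∈ upTo T → g ∈ block t → g ∈ block t′ → t ≡ t′
        distinct-blocks {t} {t′} _ _ g∈ g∈′ with ∈-map⁻ (t ,_) g∈ | ∈-map⁻ (t′ ,_) g∈′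
        ... | (_ , _ , refl) | (_ , _ , eq) = ,-injectiveˡ eq

      length-coprimeCubes : length coprimeCubes ≡ sumBelow T (λ t → a t * φ Q)
      length-coprimeCubes = begin
        length coprimeCubes                                ≡⟨ length≡sumL coprimeCubes ⟩
        sumL (λ _ → 1) coprimeCubes                        ≡⟨ sumL-concatMap (λ _ → 1) block (upTo T) ⟩
        sumL (λ t → sumL (λ _ → 1) (block t)) (upTo T)     ≡⟨ sumL-cong _ _ (upTo T) (λ {t} _ → block-size t) ⟩
        sumL (λ t → a t * φ Q) (upTo T)                    ≡⟨ sumL-upTo _ T ⟩
        sumBelow T (λ t → a t * φ Q)                       ∎
        where
        open ≡-Reasoning
        block-size : ∀ t → sumL (λ _ → 1) (block t) ≡ a t * φ Q
        block-size t = trans (sym (length≡sumL (block t)))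
          (trans (length-map (t ,_) (filter (coprime? Q) (interval (a t * Q)))) (coprimeCount-periodic Q (a t)))

      coprimeCubes⊆layer : (∀ t → a t * (p 0 ^ (t * k) * Q ^ k) ≤ n) → ∀ {g} → g ∈ coprimeCubes → g ∈ layer (suc e)
      coprimeCubes⊆layer a-fits g∈ with ∈-concatMap-elim block (upTo T) g∈
      ... | (t , t∈ , g∈′) with ∈-map⁻ (t ,_) g∈′
      ...   | (m , m∈ , refl) with ∈-filter⁻ (coprime? Q) {xs = interval (a t * Q)} m∈
      ...     | (m∈interval , Q⊥m) =
        ∈-filter⁺ (admissible? (suc e)) (∈-indices⁺ (∈-upTo⁻ t∈) (∈-interval⁺ m>0 m≤n)) (Q⊥m , fits)
        where
        m>0 = proj₁ (∈-interval⁻ m∈interval)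
        m≤aQ = proj₂ (∈-interval⁻ m∈interval)
        fits : base (t , m) * Q ^ suc k′ ≤ n
        fits = begin
          m * p 0 ^ (t * k) * Q ^ suc k′           ≤⟨ *-monoˡ-≤ (Q ^ suc k′) (*-monoˡ-≤ (p 0 ^ (t * k)) m≤aQ) ⟩
          a t * Q * p 0 ^ (t * k) * Q ^ suc k′     ≡⟨ rearrange (a t) Q (p 0 ^ (t * k)) (Q ^ suc k′) ⟩
          a t * (p 0 ^ (t * k) * (Q * Q ^ suc k′)) ≤⟨ a-fits t ⟩
          n                                        ∎
          where
          open ≤-Reasoning
          rearrange : ∀ a Q D R → a * Q * D * R ≡ a * (D * (Q * R))
          rearrange = solve-∀
        m≤n : m ≤ n
        m≤n = ≤-trans (≤*pos m (^>0 (p>0 0) (t * k)))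
                (≤-trans (≤*pos (m * p 0 ^ (t * k)) (^>0 (P>0 (suc e)) (suc k′))) fits)

    layer-size : ∀ e (a : ℕ → ℕ) → (∀ t → a t * (p 0 ^ (t * k) * P (suc e) ^ k) ≤ n) →
                 sumBelow T (λ t → a t * φ (P (suc e))) ≤ length (layer (suc e))
    layer-size e a a-fits = begin
      sumBelow T (λ t → a t * φ (P (suc e)))   ≡⟨ sym length-coprimeCubes ⟩
      length coprimeCubes                      ≤⟨ length-⊆ _≟I_ coprimeCubes (layer (suc e))
                                                     coprimeCubes-unique (coprimeCubes⊆layer a-fits) ⟩
      length (layer (suc e))                   ∎
      where
      open ≤-Reasoning
      open CoprimeCubes e a


module Fractions where

  open import Defs using (frac)
  open FiniteSums using (sumBelow)
  open import Data.Nat as ℕ using (ℕ; zero; suc; z≤n; s≤s)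
  import Data.Nat.Properties as ℕ
  open import Data.Nat.Tactic.RingSolver using (solve-∀)
  open import Data.Integer as ℤ using (+_; +≤+)
  import Data.Integer.Properties as ℤ
  open import Data.Rational as ℚ using (ℚ; 0ℚ; 1ℚ; toℚᵘ; _≤_; _+_; _*_; _-_; -_; nonNegative)
  import Data.Rational.Properties as ℚ
  open import Data.Rational.Unnormalised as ℚᵘ using (mkℚᵘ; *≡*; *≤*) renaming (_≃_ to _≃ᵘ_)
  import Data.Rational.Unnormalised.Properties as ℚᵘ
  open import Data.Rational.Solver using (module +-*-Solver)
  open +-*-Solver
  open import Relation.Binary.PropositionalEquality using (_≡_; refl; sym; trans; cong; cong₂; subst)

  -- Arithmetic of the fractions a / b (a, b ∈ ℕ, b > 0), reduced to
  -- arithmetic in ℕ by passing to unnormalised rationals.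

  private
    frac≃ : ∀ a b → toℚᵘ (frac (+ a) (suc b)) ≃ᵘ mkℚᵘ (+ a) b
    frac≃ a b = ℚ.toℚᵘ-fromℚᵘ (mkℚᵘ (+ a) b)

  frac-≤ : ∀ a b a′ b′ → 0 ℕ.< b → 0 ℕ.< b′ → a ℕ.* b′ ℕ.≤ a′ ℕ.* b → frac (+ a) b ≤ frac (+ a′) b′
  frac-≤ a (suc b) a′ (suc b′) _ _ ab′≤a′b = ℚ.toℚᵘ-cancel-≤
    (ℚᵘ.≤-respˡ-≃ (ℚᵘ.≃-sym (frac≃ a b)) (ℚᵘ.≤-respʳ-≃ (ℚᵘ.≃-sym (frac≃ a′ b′))
      (*≤* (subst₂ (ℤ.pos-* a (suc b′)) (ℤ.pos-* a′ (suc b)) (+≤+ ab′≤a′b)))))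
    where
    subst₂ : ∀ {x y u v} → x ≡ u → y ≡ v → x ℤ.≤ y → u ℤ.≤ v
    subst₂ refl refl x≤y = x≤y

  frac-≡ : ∀ a b a′ b′ → 0 ℕ.< b → 0 ℕ.< b′ → a ℕ.* b′ ≡ a′ ℕ.* b → frac (+ a) b ≡ frac (+ a′) b′
  frac-≡ a b a′ b′ b>0 b′>0 eq =
    ℚ.≤-antisym (frac-≤ a b a′ b′ b>0 b′>0 (ℕ.≤-reflexive eq)) (frac-≤ a′ b′ a b b′>0 b>0 (ℕ.≤-reflexive (sym eq)))

  frac-* : ∀ a b a′ b′ → 0 ℕ.< b → 0 ℕ.< b′ → frac (+ a) b * frac (+ a′) b′ ≡ frac (+ (a ℕ.* a′)) (b ℕ.* b′)
  frac-* a (suc b) a′ (suc b′) _ _ = ℚ.toℚᵘ-injective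
    (ℚᵘ.≃-trans (ℚ.toℚᵘ-homo-* (frac (+ a) (suc b)) (frac (+ a′) (suc b′)))
    (ℚᵘ.≃-trans (ℚᵘ.*-cong (frac≃ a b) (frac≃ a′ b′))
    (ℚᵘ.≃-trans (*≡* (cong (ℤ._* + (suc b ℕ.* suc b′)) (sym (ℤ.pos-* a a′))))
       (ℚᵘ.≃-sym (frac≃ (a ℕ.* a′) (b′ ℕ.+ b ℕ.* suc b′))))))

  frac-+ : ∀ a b a′ b′ → 0 ℕ.< b → 0 ℕ.< b′ →
           frac (+ a) b + frac (+ a′) b′ ≡ frac (+ (a ℕ.* b′ ℕ.+ a′ ℕ.* b)) (b ℕ.* b′)
  frac-+ a (suc b) a′ (suc b′) _ _ = ℚ.toℚᵘ-injective
    (ℚᵘ.≃-trans (ℚ.toℚᵘ-homo-+ (frac (+ a) (suc b)) (frac (+ a′) (suc b′)))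
    (ℚᵘ.≃-trans (ℚᵘ.+-cong (frac≃ a b) (frac≃ a′ b′))
    (ℚᵘ.≃-trans (*≡* (cong (ℤ._* + (suc b ℕ.* suc b′)) numerators))
       (ℚᵘ.≃-sym (frac≃ (a ℕ.* suc b′ ℕ.+ a′ ℕ.* suc b) (b′ ℕ.+ b ℕ.* suc b′))))))
    where
    numerators : + a ℤ.* + suc b′ ℤ.+ + a′ ℤ.* + suc b ≡ + (a ℕ.* suc b′ ℕ.+ a′ ℕ.* suc b)
    numerators = trans (cong₂ ℤ._+_ (sym (ℤ.pos-* a (suc b′))) (sym (ℤ.pos-* a′ (suc b))))
                       (sym (ℤ.pos-+ (a ℕ.* suc b′) _))

  frac≥0 : ∀ a b → 0ℚ ≤ frac (+ a) b
  frac≥0 a zero    = ℚ.≤-refl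
  frac≥0 a (suc b) = frac-≤ 0 1 a (suc b) (s≤s z≤n) (s≤s z≤n) z≤n

  ι : ℕ → ℚ
  ι a = frac (+ a) 1

  private
    1>0 : 0 ℕ.< 1
    1>0 = s≤s z≤n

  ι-+ : ∀ a b → ι a + ι b ≡ ι (a ℕ.+ b)
  ι-+ a b = trans (frac-+ a 1 b 1 1>0 1>0) (frac-≡ (a ℕ.* 1 ℕ.+ b ℕ.* 1) (1 ℕ.* 1) (a ℕ.+ b) 1 1>0 1>0 (numerator a b))
    where
    numerator : ∀ a b → (a ℕ.* 1 ℕ.+ b ℕ.* 1) ℕ.* 1 ≡ (a ℕ.+ b) ℕ.* (1 ℕ.* 1)
    numerator = solve-∀

  ι-* : ∀ a b → ι a * ι b ≡ ι (a ℕ.* b)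
  ι-* a b = frac-* a 1 b 1 1>0 1>0

  ι-mono : ∀ {a b} → a ℕ.≤ b → ι a ≤ ι b
  ι-mono {a} {b} a≤b = frac-≤ a 1 b 1 1>0 1>0 (ℕ.*-monoˡ-≤ 1 a≤b)

  ι≥0 : ∀ a → 0ℚ ≤ ι a
  ι≥0 a = frac≥0 a 1

  frac≡ι*inverse : ∀ a b → 0 ℕ.< b → frac (+ a) b ≡ ι a * frac (+ 1) b
  frac≡ι*inverse a b b>0 = sym (trans (frac-* a 1 1 b 1>0 b>0) (frac-≡ (a ℕ.* 1) (1 ℕ.* b) a b (1*b>0 b>0) b>0 (swap a b)))
    where
    1*b>0 : ∀ {b} → 0 ℕ.< b → 0 ℕ.< 1 ℕ.* b
    1*b>0 {b} b>0 = subst (0 ℕ.<_) (sym (ℕ.*-identityˡ b)) b>0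
    swap : ∀ a b → a ℕ.* 1 ℕ.* b ≡ a ℕ.* (1 ℕ.* b)
    swap = solve-∀

  ι*inverse : ∀ b → 0 ℕ.< b → ι b * frac (+ 1) b ≡ 1ℚ
  ι*inverse b b>0 = trans (sym (frac≡ι*inverse b b b>0)) (frac-≡ b b 1 1 b>0 1>0 (ℕ.*-comm b 1))

  inverse-* : ∀ b b′ → 0 ℕ.< b → 0 ℕ.< b′ → frac (+ 1) b * frac (+ 1) b′ ≡ frac (+ 1) (b ℕ.* b′)
  inverse-* b b′ = frac-* 1 b 1 b′

  *-monoʳ-≤-nonneg : ∀ {p q} r → 0ℚ ≤ r → p ≤ q → p * r ≤ q * r
  *-monoʳ-≤-nonneg r r≥0 p≤q = ℚ.*-monoʳ-≤-nonNeg r {{nonNegative r≥0}} p≤q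

  *-monoˡ-≤-nonneg : ∀ {p q} r → 0ℚ ≤ r → p ≤ q → r * p ≤ r * q
  *-monoˡ-≤-nonneg r r≥0 p≤q = ℚ.*-monoˡ-≤-nonNeg r {{nonNegative r≥0}} p≤q

  +⇒≤- : ∀ {a b c} → a + c ≤ b → a ≤ b - c
  +⇒≤- {a} {b} {c} a+c≤b = ℚ.≤-trans (ℚ.≤-reflexive (solve 2 (λ a c → a := (a :+ c) :- c) refl a c)) (ℚ.+-monoˡ-≤ (- c) a+c≤b)

  ≤+⇒-≤ : ∀ {a b c} → a ≤ b + c → a - c ≤ b
  ≤+⇒-≤ {a} {b} {c} a≤b+c = ℚ.≤-trans (ℚ.+-monoˡ-≤ (- c) a≤b+c) (ℚ.≤-reflexive (solve 2 (λ b c → (b :+ c) :- c := b) refl b c))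

  sumℚ : ℕ → (ℕ → ℚ) → ℚ
  sumℚ zero    f = 0ℚ
  sumℚ (suc D) f = sumℚ D f + f D

  ι-sumBelow : ∀ D f → ι (sumBelow D f) ≡ sumℚ D (λ e → ι (f e))
  ι-sumBelow zero    f = refl
  ι-sumBelow (suc D) f = trans (sym (ι-+ (sumBelow D f) (f D))) (cong (_+ ι (f D)) (ι-sumBelow D f))

  sumℚ-cong : ∀ D {f g} → (∀ e → f e ≡ g e) → sumℚ D f ≡ sumℚ D g
  sumℚ-cong zero    f≡g = refl
  sumℚ-cong (suc D) f≡g = cong₂ _+_ (sumℚ-cong D f≡g) (f≡g D)

  sumℚ-mono : ∀ D {f g} → (∀ e → f e ≤ g e) → sumℚ D f ≤ sumℚ D g
  sumℚ-mono zero    f≤g = ℚ.≤-refl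
  sumℚ-mono (suc D) f≤g = ℚ.+-mono-≤ (sumℚ-mono D f≤g) (f≤g D)

  sumℚ-nonneg : ∀ D f → (∀ e → 0ℚ ≤ f e) → 0ℚ ≤ sumℚ D f
  sumℚ-nonneg zero    f f≥0 = ℚ.≤-refl
  sumℚ-nonneg (suc D) f f≥0 = ℚ.+-mono-≤ {0ℚ} {sumℚ D f} {0ℚ} (sumℚ-nonneg D f f≥0) (f≥0 D)

  sumℚ-*ˡ : ∀ D r f → sumℚ D (λ e → r * f e) ≡ r * sumℚ D f
  sumℚ-*ˡ zero    r f = sym (ℚ.*-zeroʳ r)
  sumℚ-*ˡ (suc D) r f = trans (cong (_+ r * f D) (sumℚ-*ˡ D r f)) (sym (ℚ.*-distribˡ-+ r (sumℚ D f) (f D)))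

  sumℚ-+ : ∀ D f g → sumℚ D (λ e → f e + g e) ≡ sumℚ D f + sumℚ D g
  sumℚ-+ zero    f g = refl
  sumℚ-+ (suc D) f g = trans (cong (_+ (f D + g D)) (sumℚ-+ D f g))
    (solve 4 (λ a b c d → (a :+ b) :+ (c :+ d) := (a :+ c) :+ (b :+ d)) refl (sumℚ D f) (sumℚ D g) (f D) (g D))

  sumℚ-neg : ∀ D f → sumℚ D (λ e → - f e) ≡ - sumℚ D f
  sumℚ-neg zero    f = refl
  sumℚ-neg (suc D) f = trans (cong (_+ - f D) (sumℚ-neg D f)) (sym (ℚ.neg-distrib-+ (sumℚ D f) (f D)))

  sumℚ-const : ∀ D r → sumℚ D (λ _ → r) ≡ ι D * r
  sumℚ-const zero    r = sym (ℚ.*-zeroˡ r)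
  sumℚ-const (suc D) r = begin
    sumℚ D (λ _ → r) + r      ≡⟨ cong₂ _+_ (sumℚ-const D r) (sym (ℚ.*-identityˡ r)) ⟩
    ι D * r + 1ℚ * r          ≡⟨ sym (ℚ.*-distribʳ-+ r (ι D) 1ℚ) ⟩
    (ι D + ι 1) * r           ≡⟨ cong (_* r) (trans (ι-+ D 1) (cong ι (ℕ.+-comm D 1))) ⟩
    ι (suc D) * r             ∎
    where open Relation.Binary.PropositionalEquality.≡-Reasoning


module Estimates where

  open import Defs using (frac)
  open FiniteSums using (sumBelow)
  open Fractions
  open import Data.Nat as ℕ using (ℕ; zero; suc; z≤n; s≤s)
  import Data.Nat.Properties as ℕ
  open import Data.Integer using (+_; -[1+_])
  open import Data.Product using (Σ; _×_; _,_)
  open import Data.Rational as ℚ using (ℚ; 0ℚ; 1ℚ; _≤_; _+_; _*_; _-_; -_)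
  import Data.Rational.Properties as ℚ
  open import Data.Rational.Solver using (module +-*-Solver)
  open +-*-Solver
  open import Relation.Binary.PropositionalEquality using (_≡_; refl; sym; trans; cong; cong₂)

  -- Suppose a set of G numbers in [n] leaves room for
  -- W e · Σ_{t<T} a e t further numbers for every e < D (hypothesis
  -- packing), where  a e t ≈ n / (R^t Q e)  from below (hypothesis a-large).
  -- Then, dividing by n,
  --   G / n ≤ 1 - (Σ_{t<T} R^-t) (Σ_{e<D} W e / Q e) + T K / n,  K = Σ_{e<D} W e,
  -- the last term accounting for the rounding of the a e t.
  module DensityBound (n G R T D : ℕ) (n>0 : 0 ℕ.< n) (R>0 : 0 ℕ.< R)
                      (W Q : ℕ → ℕ) (Q>0 : ∀ e → 0 ℕ.< Q e) (a : ℕ → ℕ → ℕ)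
                      (packing : G ℕ.+ sumBelow D (λ e → W e ℕ.* sumBelow T (a e)) ℕ.≤ n)
                      (a-large : ∀ e t → n ℕ.≤ (a e t ℕ.+ 1) ℕ.* (R ℕ.^ t ℕ.* Q e)) where

    R^t>0 : ∀ t → 0 ℕ.< R ℕ.^ t
    R^t>0 zero    = s≤s z≤n
    R^t>0 (suc t) = ℕ.*-mono-≤ R>0 (R^t>0 t)

    denominator>0 : ∀ e t → 0 ℕ.< R ℕ.^ t ℕ.* Q e
    denominator>0 e t = ℕ.*-mono-≤ (R^t>0 t) (Q>0 e)

    geometric : ℚ
    geometric = sumℚ T (λ t → frac (+ 1) (R ℕ.^ t))

    weightedSum : ℚ
    weightedSum = sumℚ D (λ e → frac (+ W e) (Q e))

    K : ℕ
    K = sumBelow D W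

    private
      u = ι n

    a-lower : ∀ e t → u * frac (+ 1) (Q e) * frac (+ 1) (R ℕ.^ t) - 1ℚ ≤ ι (a e t)
    a-lower e t = ≤+⇒-≤ (ℚ.≤-trans (ℚ.≤-reflexive n/QR)
                    (ℚ.≤-trans (frac-≤ n (R ℕ.^ t ℕ.* Q e) (a e t ℕ.+ 1) 1 (denominator>0 e t) (s≤s z≤n)
                                  (ℕ.≤-trans (ℕ.≤-reflexive (ℕ.*-identityʳ n)) (a-large e t)))
                    (ℚ.≤-reflexive (sym (ι-+ (a e t) 1)))))
      where
      n/QR : u * frac (+ 1) (Q e) * frac (+ 1) (R ℕ.^ t) ≡ frac (+ n) (R ℕ.^ t ℕ.* Q e)
      n/QR = trans (ℚ.*-assoc u _ _)
               (trans (cong (u *_) (trans (ℚ.*-comm (frac (+ 1) (Q e)) _) (inverse-* _ _ (R^t>0 t) (Q>0 e))))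
                      (sym (frac≡ι*inverse n _ (denominator>0 e t))))

    row-lower : ∀ e → u * frac (+ 1) (Q e) * geometric - ι T ≤ sumℚ T (λ t → ι (a e t))
    row-lower e = ℚ.≤-trans (ℚ.≤-reflexive split) (sumℚ-mono T (a-lower e))
      where
      X = u * frac (+ 1) (Q e)
      split : X * geometric - ι T ≡ sumℚ T (λ t → X * frac (+ 1) (R ℕ.^ t) - 1ℚ)
      split = sym (trans (sumℚ-+ T (λ t → X * frac (+ 1) (R ℕ.^ t)) (λ _ → - 1ℚ))
                (cong₂ _+_ (sumℚ-*ˡ T X _) (trans (sumℚ-const T (- 1ℚ)) (solve 1 (λ t → t :* (:- con 1ℚ) := :- t) refl (ι T)))))

    total-lower : u * geometric * weightedSum - ι T * ι K ≤ sumℚ D (λ e → ι (W e) * sumℚ T (λ t → ι (a e t)))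
    total-lower = ℚ.≤-trans (ℚ.≤-reflexive split)
                    (sumℚ-mono D (λ e → *-monoˡ-≤-nonneg (ι (W e)) (ι≥0 (W e)) (row-lower e)))
      where
      termwise : ∀ e → ι (W e) * (u * frac (+ 1) (Q e) * geometric - ι T)
                     ≡ u * geometric * frac (+ W e) (Q e) + - (ι T * ι (W e))
      termwise e = trans
        (solve 5 (λ w u q g t → w :* (u :* q :* g :- t) := u :* g :* (w :* q) :+ (:- (t :* w))) refl
           (ι (W e)) u (frac (+ 1) (Q e)) geometric (ι T))
        (cong (λ z → u * geometric * z + - (ι T * ι (W e))) (sym (frac≡ι*inverse (W e) (Q e) (Q>0 e))))
      split : u * geometric * weightedSum - ι T * ι K ≡ sumℚ D (λ e → ι (W e) * (u * frac (+ 1) (Q e) * geometric - ι T))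
      split = sym (trans (sumℚ-cong D termwise) (trans (sumℚ-+ D _ _)
                (cong₂ _+_ (sumℚ-*ˡ D (u * geometric) _)
                           (trans (sumℚ-neg D _) (cong -_ (trans (sumℚ-*ˡ D (ι T) _) (cong (ι T *_) (sym (ι-sumBelow D W)))))))))

    packingℚ : ι G + sumℚ D (λ e → ι (W e) * sumℚ T (λ t → ι (a e t))) ≤ u
    packingℚ = ℚ.≤-trans (ℚ.≤-reflexive cast) (ι-mono packing)
      where
      cast : ι G + sumℚ D (λ e → ι (W e) * sumℚ T (λ t → ι (a e t))) ≡ ι (G ℕ.+ sumBelow D (λ e → W e ℕ.* sumBelow T (a e)))
      cast = trans (cong (λ z → ι G + z) (sym (trans (ι-sumBelow D _)
                     (sumℚ-cong D (λ e → trans (sym (ι-* (W e) _)) (cong (ι (W e) *_) (ι-sumBelow T (a e))))))))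
                   (ι-+ G _)

    density-bound : frac (+ G) n ≤ 1ℚ - geometric * weightedSum + ι T * ι K * frac (+ 1) n
    density-bound = ℚ.≤-trans (ℚ.≤-reflexive (frac≡ι*inverse G n n>0))
      (ℚ.≤-trans (*-monoʳ-≤-nonneg v (frac≥0 1 n) G≤)
      (ℚ.≤-reflexive (trans (solve 6 (λ u v g s t k → (u :- (u :* g :* s :- t :* k)) :* v := u :* v :- (u :* v) :* g :* s :+ t :* k :* v)
                              refl u v geometric weightedSum (ι T) (ι K))
                     (trans (cong (λ z → z - z * geometric * weightedSum + ι T * ι K * v) (ι*inverse n n>0))
                            (cong (λ z → 1ℚ - z * weightedSum + ι T * ι K * v) (ℚ.*-identityˡ geometric))))))
      where
      v = frac (+ 1) n
      G≤ : ι G ≤ u - (u * geometric * weightedSum - ι T * ι K)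
      G≤ = +⇒≤- (ℚ.≤-trans (ℚ.+-monoʳ-≤ (ι G) total-lower) packingℚ)

  module GeometricSeries (r : ℕ) where

    R : ℕ
    R = suc (suc r)

    limit : ℚ
    limit = frac (+ R) (suc r)

    partial : ℕ → ℚ
    partial T = sumℚ T (λ t → frac (+ 1) (R ℕ.^ t))

    R^t>0 : ∀ t → 0 ℕ.< R ℕ.^ t
    R^t>0 zero    = s≤s z≤n
    R^t>0 (suc t) = ℕ.*-mono-≤ {1} {R} (s≤s z≤n) (R^t>0 t)

    fixed-point : 1ℚ + limit * frac (+ 1) R ≡ limit
    fixed-point =
      trans (cong (λ z → 1ℚ + z) (trans (frac-* R (suc r) 1 R (s≤s z≤n) (s≤s z≤n))
                             (frac-≡ (R ℕ.* 1) (suc r ℕ.* R) 1 (suc r) (s≤s z≤n) (s≤s z≤n) (e₁ r))))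
            (trans (frac-+ 1 1 1 (suc r) (s≤s z≤n) (s≤s z≤n))
                   (frac-≡ (1 ℕ.* suc r ℕ.+ 1 ℕ.* 1) (1 ℕ.* suc r) R (suc r) (s≤s z≤n) (s≤s z≤n) (e₂ r)))
      where
      e₁ : ∀ r → suc (suc r) ℕ.* 1 ℕ.* suc r ≡ 1 ℕ.* (suc r ℕ.* suc (suc r))
      e₁ = solve-∀
        where open import Data.Nat.Tactic.RingSolver using (solve-∀)
      e₂ : ∀ r → (1 ℕ.* suc r ℕ.+ 1 ℕ.* 1) ℕ.* suc r ≡ suc (suc r) ℕ.* (1 ℕ.* suc r)
      e₂ = solve-∀
        where open import Data.Nat.Tactic.RingSolver using (solve-∀)

    partial+remainder : ∀ T → partial T + limit * frac (+ 1) (R ℕ.^ T) ≡ limit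
    partial+remainder zero    = trans (ℚ.+-identityˡ (limit * 1ℚ)) (ℚ.*-identityʳ limit)
    partial+remainder (suc T) = begin
      partial T + x + limit * frac (+ 1) (R ℕ.^ suc T)   ≡⟨ cong (λ z → partial T + x + limit * z) R^-[T+1] ⟩
      partial T + x + limit * (x * y)                    ≡⟨ solve 4 (λ G x f y → G :+ x :+ f :* (x :* y) := G :+ f :* x :+ x :* (con 1ℚ :+ f :* y :- f)) refl (partial T) x limit y ⟩
      partial T + limit * x + x * (1ℚ + limit * y - limit) ≡⟨ cong (λ z → partial T + limit * x + x * (z - limit)) fixed-point ⟩
      partial T + limit * x + x * (limit - limit)        ≡⟨ cong (λ z → partial T + limit * x + x * z) (ℚ.+-inverseʳ limit) ⟩
      partial T + limit * x + x * 0ℚ                     ≡⟨ trans (cong (λ z → partial T + limit * x + z) (ℚ.*-zeroʳ x)) (ℚ.+-identityʳ _) ⟩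
      partial T + limit * x                              ≡⟨ partial+remainder T ⟩
      limit                                              ∎
      where
      open Relation.Binary.PropositionalEquality.≡-Reasoning
      x = frac (+ 1) (R ℕ.^ T)
      y = frac (+ 1) R
      R^-[T+1] : frac (+ 1) (R ℕ.^ suc T) ≡ x * y
      R^-[T+1] = trans (cong (frac (+ 1)) (ℕ.*-comm R (R ℕ.^ T))) (sym (inverse-* _ _ (R^t>0 T) (s≤s z≤n)))

    partial≡ : ∀ T → partial T ≡ limit - limit * frac (+ 1) (R ℕ.^ T)
    partial≡ T = trans (solve 2 (λ g z → g := g :+ z :- z) refl (partial T) (limit * frac (+ 1) (R ℕ.^ T)))
                       (cong (_- limit * frac (+ 1) (R ℕ.^ T)) (partial+remainder T))

  -- A series whose terms are dominated by a sequence decaying at least like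
  -- (3/4)^e has tails bounded by 3 times the dominating sequence:
  --   Σ_{e<D+j} s e + 3 ρ(D+j) ≤ Σ_{e<D} s e + 3 ρ D.
  module GeometricTail (s ρ : ℕ → ℚ) (s≤ρ : ∀ e → s e ≤ ρ (suc e))
                       (ρ-decay : ∀ e → ρ (suc e) + ι 3 * ρ (suc e) ≡ ι 3 * ρ e) where

    tail-bound : ∀ D j → sumℚ (D ℕ.+ j) s + ι 3 * ρ (D ℕ.+ j) ≤ sumℚ D s + ι 3 * ρ D
    tail-bound D zero    = ℚ.≤-reflexive (cong (λ z → sumℚ z s + ι 3 * ρ z) (ℕ.+-identityʳ D))
    tail-bound D (suc j) rewrite ℕ.+-suc D j =
      ℚ.≤-trans (ℚ.≤-trans (ℚ.+-monoˡ-≤ (ι 3 * ρ (suc m)) (ℚ.+-monoʳ-≤ (sumℚ m s) (s≤ρ m)))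
                   (ℚ.≤-reflexive (trans (ℚ.+-assoc (sumℚ m s) _ _) (cong (λ z → sumℚ m s + z) (ρ-decay m)))))
                (tail-bound D j)
      where m = D ℕ.+ j

  unit-fraction-below : ∀ ε → 0ℚ ℚ.< ε → Σ ℕ λ M → 0 ℕ.< M × frac (+ 1) M ≤ ε
  unit-fraction-below (ℚ.mkℚ (+ suc x) d coprime) _ =
    suc d , s≤s z≤n ,
    ℚ.≤-trans (frac-≤ 1 (suc d) (suc x) (suc d) (s≤s z≤n) (s≤s z≤n) (ℕ.*-monoˡ-≤ (suc d) {1} {suc x} (s≤s z≤n)))
              (ℚ.≤-reflexive (ℚ.fromℚᵘ-toℚᵘ (ℚ.mkℚ (+ suc x) d coprime)))
  unit-fraction-below (ℚ.mkℚ (+ zero) d _) ε>0 with () ← ℚ.positive ε>0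
  unit-fraction-below (ℚ.mkℚ -[1+ x ] d _) ε>0 with () ← ℚ.positive ε>0

  -- 3^D (3 + D) ≤ 3 · 4^D, so that (3/4)^D decays faster than 1/D.
  3^D[3+D]≤3·4^D : ∀ D → 3 ℕ.^ D ℕ.* (3 ℕ.+ D) ℕ.≤ 3 ℕ.* 4 ℕ.^ D
  3^D[3+D]≤3·4^D zero    = ℕ.≤-refl
  3^D[3+D]≤3·4^D (suc D) = begin
    3 ℕ.* x ℕ.* (3 ℕ.+ suc D)              ≡⟨ e₁ x D ⟩
    3 ℕ.* (x ℕ.* (3 ℕ.+ D)) ℕ.+ x ℕ.* 3    ≤⟨ ℕ.+-monoʳ-≤ (3 ℕ.* (x ℕ.* (3 ℕ.+ D))) (ℕ.*-monoʳ-≤ x (ℕ.m≤m+n 3 D)) ⟩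
    3 ℕ.* (x ℕ.* (3 ℕ.+ D)) ℕ.+ x ℕ.* (3 ℕ.+ D) ≡⟨ e₂ x D ⟩
    4 ℕ.* (x ℕ.* (3 ℕ.+ D))                ≤⟨ ℕ.*-monoʳ-≤ 4 (3^D[3+D]≤3·4^D D) ⟩
    4 ℕ.* (3 ℕ.* 4 ℕ.^ D)                  ≡⟨ e₃ (4 ℕ.^ D) ⟩
    3 ℕ.* 4 ℕ.^ suc D                      ∎
    where
    open ℕ.≤-Reasoning
    open import Data.Nat.Tactic.RingSolver using (solve-∀)
    x = 3 ℕ.^ D
    e₁ : ∀ x D → 3 ℕ.* x ℕ.* (3 ℕ.+ suc D) ≡ 3 ℕ.* (x ℕ.* (3 ℕ.+ D)) ℕ.+ x ℕ.* 3
    e₁ = solve-∀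
    e₂ : ∀ x D → 3 ℕ.* (x ℕ.* (3 ℕ.+ D)) ℕ.+ x ℕ.* (3 ℕ.+ D) ≡ 4 ℕ.* (x ℕ.* (3 ℕ.+ D))
    e₂ = solve-∀
    e₃ : ∀ y → 4 ℕ.* (3 ℕ.* y) ≡ 3 ℕ.* (4 ℕ.* y)
    e₃ = solve-∀

  T<R^T : ∀ r T → suc T ℕ.≤ suc (suc r) ℕ.^ T
  T<R^T r zero    = ℕ.≤-refl
  T<R^T r (suc T) = begin
    suc (suc T)                 ≤⟨ s≤s (ℕ.m≤m+n (suc T) T) ⟩
    suc (suc T ℕ.+ T)           ≡⟨ double T ⟩
    2 ℕ.* suc T                 ≤⟨ ℕ.*-monoʳ-≤ 2 (T<R^T r T) ⟩
    2 ℕ.* suc (suc r) ℕ.^ T     ≤⟨ ℕ.*-monoˡ-≤ (suc (suc r) ℕ.^ T) {2} {suc (suc r)} (s≤s (s≤s z≤n)) ⟩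
    suc (suc r) ℕ.^ suc T       ∎
    where
    open ℕ.≤-Reasoning
    double : ∀ T → suc (suc T ℕ.+ T) ≡ 2 ℕ.* suc T
    double = Data.Nat.Tactic.RingSolver.solve-∀
      where import Data.Nat.Tactic.RingSolver

  collect-errors : ∀ {x g S S′ f u τ x₃ ε₁ ε₂ ε₃ ε} →
    x ≤ 1ℚ - g * S + x₃ → g ≡ f - f * u → S′ ≤ S + τ → 0ℚ ≤ f →
    f * τ ≤ ε₁ → f * u * S ≤ ε₂ → x₃ ≤ ε₃ → ε₁ + ε₂ + ε₃ ≤ ε → x ≤ 1ℚ - f * S′ + ε
  collect-errors {x} {g} {S} {S′} {f} {u} {τ} {x₃} {ε₁} {ε₂} {ε₃} {ε} x≤ g≡ S′≤ f≥0 e₁ e₂ e₃ ε≥ =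
    ℚ.≤-trans x≤ (ℚ.≤-trans (ℚ.≤-reflexive regroup) (ℚ.+-monoʳ-≤ (1ℚ - f * S′) errors≤ε))
    where
    regroup : 1ℚ - g * S + x₃ ≡ 1ℚ - f * S′ + (f * (S′ - S) + f * u * S + x₃)
    regroup = trans (cong (λ z → 1ℚ - z * S + x₃) g≡)
      (solve 5 (λ f u S S′ x₃ → con 1ℚ :- (f :- f :* u) :* S :+ x₃ := con 1ℚ :- f :* S′ :+ (f :* (S′ :- S) :+ f :* u :* S :+ x₃))
         refl f u S S′ x₃)
    errors≤ε : f * (S′ - S) + f * u * S + x₃ ≤ ε
    errors≤ε = ℚ.≤-trans (ℚ.+-mono-≤ (ℚ.+-mono-≤ (ℚ.≤-trans (*-monoˡ-≤-nonneg f f≥0 (≤+⇒-≤ (ℚ.≤-trans S′≤ (ℚ.≤-reflexive (ℚ.+-comm S τ))))) e₁) e₂) e₃) ε≥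


module SeriesBounds where

  open import Defs
  open FiniteSums using (interval; length-interval)
  open NumberTheory
  open Fractions
  open import Data.Nat as ℕ using (ℕ; zero; suc; z≤n; s≤s; _+_; _*_; _^_; _∸_; _≤_; _<_)
  open import Data.Nat.Properties
  open import Data.Nat.Primality using (Prime; prime[2])
  open import Data.Nat.Tactic.RingSolver using (solve-∀)
  open import Data.Integer as ℤ using (+_)
  import Data.Integer.Properties as ℤ
  open import Data.Rational as ℚ using (ℚ; 0ℚ; 1ℚ) renaming (_≤_ to _≤ℚ_; _+_ to _+ℚ_; _*_ to _*ℚ_)
  import Data.Rational.Properties as ℚ
  open import Data.List.Properties using (length-filter)
  open import Data.Product using (_,_)
  open import Relation.Nullary using (contradiction)
  open import Relation.Binary.PropositionalEquality using (_≡_; sym; trans; cong; subst; module ≡-Reasoning)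

  first-prime : (p : ℕ → ℕ) → IsPrimeEnumeration p → p 0 ≡ 2
  first-prime p (p-prime , p-increasing , p-complete) with p-complete 2 prime[2]
  ... | (zero  , p0≡2) = p0≡2
  ... | (suc i , pi≡2) = contradiction (≤-trans (p-increasing 0 (suc i) (s≤s z≤n)) (≤-reflexive pi≡2)) (<⇒≱ (s≤s (prime≥2 (p-prime 0))))

  φ≤ : ∀ m → φ m ≤ m
  φ≤ m = ≤-trans (length-filter _ (interval m)) (≤-reflexive (length-interval m))

  summand≡ : ∀ k c p e → c (suc e) ≤ k * c e →
    summand k c p e ≡ frac (+ ((k * c e ∸ c (suc e)) * φ (primorial p (suc e)))) (primorial p (suc e) ^ k)
  summand≡ k c p e c-step = cong (λ z → frac z (primorial p (suc e) ^ k))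
    (trans (cong (ℤ._* + φ (primorial p (suc e))) (trans (ℤ.[+m]-[+n]≡m⊖n (k * c e) (c (suc e))) (ℤ.⊖-≥ c-step)))
           (sym (ℤ.pos-* (k * c e ∸ c (suc e)) _)))

  ρ : ℕ → ℚ
  ρ e = frac (+ (3 ^ e)) (4 ^ e)

  4^e>0 : ∀ e → 0 < 4 ^ e
  4^e>0 e = ^>0 (s≤s z≤n) e

  ρ≥0 : ∀ e → 0ℚ ≤ℚ ρ e
  ρ≥0 e = frac≥0 (3 ^ e) (4 ^ e)

  3ρ≥0 : ∀ e → 0ℚ ≤ℚ ι 3 *ℚ ρ e
  3ρ≥0 e = ℚ.≤-trans (ℚ.≤-reflexive (sym (ℚ.*-zeroʳ (ι 3)))) (*-monoˡ-≤-nonneg (ι 3) (ι≥0 3) (ρ≥0 e))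

  ρ-decay : ∀ e → ρ (suc e) +ℚ ι 3 *ℚ ρ (suc e) ≡ ι 3 *ℚ ρ e
  ρ-decay e = begin
    ρ (suc e) +ℚ ι 3 *ℚ ρ (suc e)      ≡⟨ cong (_+ℚ ι 3 *ℚ ρ (suc e)) (sym (ℚ.*-identityˡ (ρ (suc e)))) ⟩
    1ℚ *ℚ ρ (suc e) +ℚ ι 3 *ℚ ρ (suc e) ≡⟨ sym (ℚ.*-distribʳ-+ (ρ (suc e)) 1ℚ (ι 3)) ⟩
    (1ℚ +ℚ ι 3) *ℚ ρ (suc e)           ≡⟨ cong (_*ℚ ρ (suc e)) (ι-+ 1 3) ⟩
    ι 4 *ℚ ρ (suc e)                   ≡⟨ frac-* 4 1 (3 ^ suc e) (4 ^ suc e) (s≤s z≤n) (4^e>0 (suc e)) ⟩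
    frac (+ (4 * 3 ^ suc e)) (1 * 4 ^ suc e) ≡⟨ frac-≡ _ _ _ _ (1*>0 (4^e>0 (suc e))) (1*>0 (4^e>0 e)) (cross (3 ^ e) (4 ^ e)) ⟩
    frac (+ (3 * 3 ^ e)) (1 * 4 ^ e)   ≡⟨ sym (frac-* 3 1 (3 ^ e) (4 ^ e) (s≤s z≤n) (4^e>0 e)) ⟩
    ι 3 *ℚ ρ e                         ∎
    where
    open ≡-Reasoning
    1*>0 : ∀ {b} → 0 < b → 0 < 1 * b
    1*>0 {b} b>0 = subst (0 <_) (sym (*-identityˡ b)) b>0
    cross : ∀ x y → 4 * (3 * x) * (1 * y) ≡ 3 * x * (1 * (4 * y))
    cross = solve-∀

  4k≤3·2^[k-1] : ∀ k″ → 4 * suc (suc (suc k″)) ≤ 3 * 2 ^ suc (suc k″)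
  4k≤3·2^[k-1] zero     = ≤-refl
  4k≤3·2^[k-1] (suc k″) = begin
    4 * suc (suc (suc (suc k″)))            ≡⟨ split k″ ⟩
    4 * suc (suc (suc k″)) + 4              ≤⟨ +-mono-≤ (4k≤3·2^[k-1] k″) 4≤ ⟩
    3 * 2 ^ suc (suc k″) + 3 * 2 ^ suc (suc k″) ≡⟨ double (2 ^ suc (suc k″)) ⟩
    3 * 2 ^ suc (suc (suc k″))              ∎
    where
    open ≤-Reasoning
    split : ∀ k → 4 * suc (suc (suc (suc k))) ≡ 4 * suc (suc (suc k)) + 4
    split = solve-∀
    double : ∀ x → 3 * x + 3 * x ≡ 3 * (2 * x)
    double = solve-∀
    4≤ : 4 ≤ 3 * 2 ^ suc (suc k″)
    4≤ = ≤-trans (s≤s (s≤s (s≤s (s≤s z≤n)))) (*-monoʳ-≤ 3 (^-monoʳ-≤ 2 {2} {suc (suc k″)} (s≤s (s≤s z≤n))))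

  -- The summands of the series decay geometrically:
  --   (k c'_e - c'_{e+1}) φ(P_{e+1}) / P_{e+1}^k ≤ (3/4)^(e+1),
  -- from c'_e ≤ k^e, φ(P) ≤ P and P_{e+1} ≥ 2^(e+1).
  module SummandBound (p : ℕ → ℕ) (p-prime : ∀ i → Prime (p i)) (p-increasing : ∀ i j → i < j → p i < p j)
                      (k″ : ℕ) (c : ℕ → ℕ) (c≤k^e : ∀ e → c e ≤ suc (suc (suc k″)) ^ e) where
    open Primorials p p-prime p-increasing

    k : ℕ
    k = suc (suc (suc k″))

    P≥2^d : ∀ d → 2 ^ d ≤ P d
    P≥2^d zero    = ≤-refl
    P≥2^d (suc d) = ≤-trans (≤-reflexive (*-comm 2 (2 ^ d)))
                      (≤-trans (*-mono-≤ (P≥2^d d) (p≥2 d)) (≤-reflexive (sym (P-suc d))))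

    P^k>0 : ∀ e → 0 < P (suc e) ^ k
    P^k>0 e = ^>0 (P>0 (suc e)) k

    numerator-bound : ∀ e → (k * c e ∸ c (suc e)) * φ (P (suc e)) * 4 ^ suc e ≤ 3 ^ suc e * P (suc e) ^ k
    numerator-bound e = begin
      (k * c e ∸ c (suc e)) * φ Q * 4 ^ suc e      ≤⟨ *-monoˡ-≤ (4 ^ suc e) (*-mono-≤ (≤-trans (m∸n≤m (k * c e) (c (suc e))) (*-monoʳ-≤ k (c≤k^e e))) (φ≤ Q)) ⟩
      k ^ suc e * Q * 4 ^ suc e                    ≡⟨ x*y*z≡y*[x*z] (k ^ suc e) Q (4 ^ suc e) ⟩
      Q * (k ^ suc e * 4 ^ suc e)                  ≡⟨ cong (Q *_) (sym (^-distribʳ-* k 4 (suc e))) ⟩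
      Q * (k * 4) ^ suc e                          ≤⟨ *-monoʳ-≤ Q (^-monoˡ-≤ (suc e) (≤-trans (≤-reflexive (*-comm k 4)) (4k≤3·2^[k-1] k″))) ⟩
      Q * (3 * 2 ^ m) ^ suc e                      ≡⟨ cong (Q *_) (^-distribʳ-* 3 (2 ^ m) (suc e)) ⟩
      Q * (3 ^ suc e * (2 ^ m) ^ suc e)            ≡⟨ cong (λ z → Q * (3 ^ suc e * z)) (trans (^-*-assoc 2 m (suc e)) (trans (cong (2 ^_) (*-comm m (suc e))) (sym (^-*-assoc 2 (suc e) m)))) ⟩
      Q * (3 ^ suc e * (2 ^ suc e) ^ m)            ≤⟨ *-monoʳ-≤ Q (*-monoʳ-≤ (3 ^ suc e) (^-monoˡ-≤ m (P≥2^d (suc e)))) ⟩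
      Q * (3 ^ suc e * Q ^ m)                      ≡⟨ x*[y*z]≡y*[x*z] Q (3 ^ suc e) (Q ^ m) ⟩
      3 ^ suc e * Q ^ k                            ∎
      where
      open ≤-Reasoning
      Q = P (suc e)
      m = suc (suc k″)
      x*y*z≡y*[x*z] : ∀ a b c → a * b * c ≡ b * (a * c)
      x*y*z≡y*[x*z] = solve-∀
      x*[y*z]≡y*[x*z] : ∀ a b c → a * (b * c) ≡ b * (a * c)
      x*[y*z]≡y*[x*z] = solve-∀

    summand-bound : ∀ e → frac (+ ((k * c e ∸ c (suc e)) * φ (P (suc e)))) (P (suc e) ^ k) ≤ℚ ρ (suc e)
    summand-bound e = frac-≤ _ _ _ _ (P^k>0 e) (4^e>0 (suc e)) (numerator-bound e)


module Conclusion where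

  open import Defs
  open FiniteSums
  open NumberTheory
  open MoserNumbers
  open CubePacking
  open Fractions
  open Estimates
  open SeriesBounds
  open import Data.Nat as ℕ using (ℕ; zero; suc; z≤n; s≤s; >-nonZero)
  import Data.Nat.Properties as ℕ
  open import Data.Nat.DivMod using (_/_; _%_; m/n*n≤m; m≡m%n+[m/n]*n; m%n<n)
  open import Data.Nat.Tactic.RingSolver using (solve-∀)
  open import Data.Integer using (+_)
  open import Data.Rational as ℚ using (ℚ; 0ℚ; 1ℚ; _+_; _-_; _*_) renaming (_≤_ to _≤ℚ_)
  import Data.Rational.Properties as ℚ
  open import Data.Rational.Solver using (module +-*-Solver)
  open +-*-Solver
  open import Data.List using (List; length)
  open import Data.List.Membership.Propositional using (_∈_)
  open import Data.List.Relation.Unary.Unique.Propositional using (Unique)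
  open import Data.Product using (_,_; proj₁; proj₂)
  open import Relation.Nullary using (¬_)
  open import Relation.Binary.PropositionalEquality using (_≡_; refl; sym; trans; cong; cong₂; subst)

  -- The three error terms, each at most 1/(3M), when T = 18 M and D₁ = 54 M.
  module ErrorTerms (r M : ℕ) (M>0 : 0 ℕ.< M) where
    open GeometricSeries r using (R; limit; R^t>0)

    T D₁ : ℕ
    T  = 18 ℕ.* M
    D₁ = 54 ℕ.* M

    third : ℚ
    third = frac (+ 1) (3 ℕ.* M)

    3M>0 : 0 ℕ.< 3 ℕ.* M
    3M>0 = ℕ.≤-trans M>0 (ℕ.m≤n*m M 3)

    limit≥0 : 0ℚ ≤ℚ limit
    limit≥0 = frac≥0 R (suc r)

    limit≤2 : limit ≤ℚ ι 2
    limit≤2 = frac-≤ R (suc r) 2 1 (s≤s z≤n) (s≤s z≤n) (ℕ.≤-trans (ℕ.≤-reflexive (ℕ.*-identityʳ R))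
                (ℕ.≤-trans (s≤s (s≤s (ℕ.m≤m+n r r))) (ℕ.≤-reflexive (double r))))
      where
      double : ∀ r → suc (suc (r ℕ.+ r)) ≡ 2 ℕ.* suc r
      double = solve-∀

    -- f · 3 (3/4)^(54 M) ≤ 6 (3/4)^(54 M) ≤ 1/(3M).
    tail-error : limit * (ι 3 * ρ D₁) ≤ℚ third
    tail-error = ℚ.≤-trans (*-monoʳ-≤-nonneg (ι 3 * ρ D₁) (3ρ≥0 D₁) limit≤2)
      (ℚ.≤-trans (ℚ.≤-reflexive as-fraction) (frac-≤ _ _ 1 (3 ℕ.* M) (4^e>0 D₁) 3M>0 cross))
      where
      x = 3 ℕ.^ D₁
      as-fraction : ι 2 * (ι 3 * ρ D₁) ≡ frac (+ (2 ℕ.* (3 ℕ.* x))) (4 ℕ.^ D₁)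
      as-fraction = begin
        ι 2 * (ι 3 * ρ D₁)                          ≡⟨ cong (λ z → ι 2 * (ι 3 * z)) (frac≡ι*inverse x (4 ℕ.^ D₁) (4^e>0 D₁)) ⟩
        ι 2 * (ι 3 * (ι x * y))                     ≡⟨ solve 4 (λ a b c d → a :* (b :* (c :* d)) := a :* (b :* c) :* d) refl (ι 2) (ι 3) (ι x) y ⟩
        ι 2 * (ι 3 * ι x) * y                       ≡⟨ cong (λ z → ι 2 * z * y) (ι-* 3 x) ⟩
        ι 2 * ι (3 ℕ.* x) * y                       ≡⟨ cong (_* y) (ι-* 2 (3 ℕ.* x)) ⟩
        ι (2 ℕ.* (3 ℕ.* x)) * y                     ≡⟨ sym (frac≡ι*inverse _ _ (4^e>0 D₁)) ⟩
        frac (+ (2 ℕ.* (3 ℕ.* x))) (4 ℕ.^ D₁)       ∎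
        where
        open Relation.Binary.PropositionalEquality.≡-Reasoning
        y = frac (+ 1) (4 ℕ.^ D₁)
      cross : 2 ℕ.* (3 ℕ.* x) ℕ.* (3 ℕ.* M) ℕ.≤ 1 ℕ.* 4 ℕ.^ D₁
      cross = ℕ.*-cancelˡ-≤ 3 (begin
        3 ℕ.* (2 ℕ.* (3 ℕ.* x) ℕ.* (3 ℕ.* M))   ≡⟨ regroup x M ⟩
        x ℕ.* (54 ℕ.* M)                        ≤⟨ ℕ.*-monoʳ-≤ x (ℕ.m≤n+m D₁ 3) ⟩
        x ℕ.* (3 ℕ.+ D₁)                        ≤⟨ 3^D[3+D]≤3·4^D D₁ ⟩
        3 ℕ.* 4 ℕ.^ D₁                          ≡⟨ cong (3 ℕ.*_) (sym (ℕ.*-identityˡ (4 ℕ.^ D₁))) ⟩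
        3 ℕ.* (1 ℕ.* 4 ℕ.^ D₁)                  ∎)
        where
        open ℕ.≤-Reasoning
        regroup : ∀ x M → 3 ℕ.* (2 ℕ.* (3 ℕ.* x) ℕ.* (3 ℕ.* M)) ≡ x ℕ.* (54 ℕ.* M)
        regroup = solve-∀

    -- f R^(-18 M) S ≤ 6 / R^(18 M) ≤ 1/(3M) for 0 ≤ S ≤ 3.
    geometric-error : ∀ {S} → 0ℚ ≤ℚ S → S ≤ℚ ι 3 → limit * frac (+ 1) (R ℕ.^ T) * S ≤ℚ third
    geometric-error {S} S≥0 S≤3 =
      ℚ.≤-trans (*-monoˡ-≤-nonneg (limit * u) fu≥0 S≤3)
      (ℚ.≤-trans (*-monoʳ-≤-nonneg (ι 3) (ι≥0 3) (*-monoʳ-≤-nonneg u u≥0 limit≤2))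
      (ℚ.≤-trans (ℚ.≤-reflexive as-fraction) (frac-≤ 6 (R ℕ.^ T) 1 (3 ℕ.* M) (R^t>0 T) 3M>0 cross)))
      where
      u = frac (+ 1) (R ℕ.^ T)
      u≥0 = frac≥0 1 (R ℕ.^ T)
      fu≥0 : 0ℚ ≤ℚ limit * u
      fu≥0 = ℚ.≤-trans (ℚ.≤-reflexive (sym (ℚ.*-zeroʳ limit))) (*-monoˡ-≤-nonneg limit limit≥0 u≥0)
      as-fraction : ι 2 * u * ι 3 ≡ frac (+ 6) (R ℕ.^ T)
      as-fraction = trans (solve 3 (λ a b c → a :* b :* c := a :* c :* b) refl (ι 2) u (ι 3))
        (trans (cong (_* u) (ι-* 2 3)) (sym (frac≡ι*inverse 6 _ (R^t>0 T))))
      cross : 6 ℕ.* (3 ℕ.* M) ℕ.≤ 1 ℕ.* R ℕ.^ T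
      cross = ℕ.≤-trans (ℕ.≤-reflexive (regroup M))
                (ℕ.≤-trans (ℕ.n≤1+n T) (ℕ.≤-trans (T<R^T r T) (ℕ.≤-reflexive (sym (ℕ.*-identityˡ _)))))
        where
        regroup : ∀ M → 6 ℕ.* (3 ℕ.* M) ≡ 18 ℕ.* M
        regroup = solve-∀

    rounding-error : ∀ K n → T ℕ.* K ℕ.* (3 ℕ.* M) ℕ.< n → ι T * ι K * frac (+ 1) n ≤ℚ third
    rounding-error K n n> = ℚ.≤-trans
      (ℚ.≤-reflexive (trans (cong (_* frac (+ 1) n) (ι-* T K)) (sym (frac≡ι*inverse (T ℕ.* K) n n>0))))
      (frac-≤ (T ℕ.* K) n 1 (3 ℕ.* M) n>0 3M>0 (ℕ.≤-trans (ℕ.n≤1+n _) (ℕ.≤-trans n> (ℕ.≤-reflexive (sym (ℕ.*-identityˡ n))))))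
      where
      n>0 : 0 ℕ.< n
      n>0 = ℕ.≤-trans (s≤s z≤n) n>

    three-thirds : third + third + third ≤ℚ frac (+ 1) M
    three-thirds = ℚ.≤-reflexive (begin
      third + third + third                   ≡⟨ solve 1 (λ x → x :+ x :+ x := (con 1ℚ :+ con 1ℚ :+ con 1ℚ) :* x) refl third ⟩
      (1ℚ + 1ℚ + 1ℚ) * third                  ≡⟨ cong (_* third) (trans (cong (_+ 1ℚ) (ι-+ 1 1)) (ι-+ 2 1)) ⟩
      ι 3 * third                             ≡⟨ sym (frac≡ι*inverse 3 (3 ℕ.* M) 3M>0) ⟩
      frac (+ 3) (3 ℕ.* M)                    ≡⟨ frac-≡ 3 (3 ℕ.* M) 1 M 3M>0 M>0 (sym (ℕ.*-identityˡ (3 ℕ.* M))) ⟩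
      frac (+ 1) M                            ∎)
      where open Relation.Binary.PropositionalEquality.≡-Reasoning

  module Truncation (k″ : ℕ) (c : ℕ → ℕ) (isMoser : ∀ d → IsMoserNumber d (suc (suc (suc k″))) (c d))
                    (p : ℕ → ℕ) (isPrimeEnumeration : IsPrimeEnumeration p) where

    k : ℕ
    k = suc (suc (suc k″))

    p-prime = proj₁ isPrimeEnumeration
    p-increasing = proj₁ (proj₂ isPrimeEnumeration)
    open Primorials p p-prime p-increasing

    -- R = 2^k, written as r + 2.
    r : ℕ
    r = 2 ℕ.^ k ℕ.∸ 2

    2^k≡r+2 : 2 ℕ.^ k ≡ suc (suc r)
    2^k≡r+2 = sym (undo (ℕ.^-monoʳ-≤ 2 {1} {k} (s≤s z≤n)))
      where
      undo : ∀ {m} → 2 ℕ.≤ m → suc (suc (m ℕ.∸ 2)) ≡ m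
      undo (s≤s (s≤s _)) = refl

    open GeometricSeries r using (R; limit; partial; partial≡; R^t>0)

    -- The factor 2^k / (2^k - 1) is the sum of the geometric series.
    factor≡limit : factor k ≡ limit
    factor≡limit = cong (λ z → frac (+ z) (z ℕ.∸ 1)) 2^k≡r+2

    W : ℕ → ℕ
    W e = (k ℕ.* c e ℕ.∸ c (suc e)) ℕ.* φ (P (suc e))

    Q : ℕ → ℕ
    Q e = P (suc e) ℕ.^ k

    Q>0 : ∀ e → 0 ℕ.< Q e
    Q>0 e = ^>0 (P>0 (suc e)) k

    partialSum≡ : ∀ D → partialSum k c p D ≡ sumℚ D (λ e → frac (+ W e) (Q e))
    partialSum≡ zero    = refl
    partialSum≡ (suc D) = cong₂ _+_ (partialSum≡ D) (summand≡ k c p D (Cube.moser-ratio k c isMoser D))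

    p₀^[t*k]≡R^t : ∀ t → p 0 ℕ.^ (t ℕ.* k) ≡ R ℕ.^ t
    p₀^[t*k]≡R^t t = begin
      p 0 ℕ.^ (t ℕ.* k)   ≡⟨ cong₂ ℕ._^_ (first-prime p isPrimeEnumeration) (ℕ.*-comm t k) ⟩
      2 ℕ.^ (k ℕ.* t)     ≡⟨ sym (ℕ.^-*-assoc 2 k t) ⟩
      (2 ℕ.^ k) ℕ.^ t     ≡⟨ cong (ℕ._^ t) 2^k≡r+2 ⟩
      R ℕ.^ t             ∎
      where open Relation.Binary.PropositionalEquality.≡-Reasoning

    cubeSize : ℕ → ℕ → ℕ
    cubeSize e t = R ℕ.^ t ℕ.* Q e

    cubeSize>0 : ∀ e t → 0 ℕ.< cubeSize e t
    cubeSize>0 e t = ℕ.*-mono-≤ (R^t>0 t) (Q>0 e)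

    fitting : ℕ → ℕ → ℕ → ℕ
    fitting n e t = _/_ n (cubeSize e t) {{>-nonZero (cubeSize>0 e t)}}

    fitting-fits : ∀ n e t → fitting n e t ℕ.* (p 0 ℕ.^ (t ℕ.* k) ℕ.* P (suc e) ℕ.^ k) ℕ.≤ n
    fitting-fits n e t rewrite p₀^[t*k]≡R^t t = m/n*n≤m n (cubeSize e t) {{>-nonZero (cubeSize>0 e t)}}

    fitting-large : ∀ n e t → n ℕ.≤ (fitting n e t ℕ.+ 1) ℕ.* cubeSize e t
    fitting-large n e t = begin
      n                                          ≡⟨ m≡m%n+[m/n]*n n (cubeSize e t) ⟩
      n % cubeSize e t ℕ.+ a ℕ.* cubeSize e t    ≤⟨ ℕ.+-monoˡ-≤ (a ℕ.* cubeSize e t) (ℕ.<⇒≤ (m%n<n n (cubeSize e t))) ⟩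
      cubeSize e t ℕ.+ a ℕ.* cubeSize e t        ≡⟨ cong (ℕ._* cubeSize e t) (ℕ.+-comm 1 a) ⟩
      (a ℕ.+ 1) ℕ.* cubeSize e t                 ∎
      where
      open ℕ.≤-Reasoning
      instance _ = >-nonZero (cubeSize>0 e t)
      a = fitting n e t

    -- It combines the packing inequality with the lower bound on the number of
    -- cubes of each level, and divides by n (DensityBound).
    truncated-bound : ∀ n T D → 0 ℕ.< n → (A : List ℕ) → Unique A → (∀ x → x ∈ A → InRange n x) → ¬ ContainsGP k A →
      frac (+ length A) n ≤ℚ 1ℚ - partial T * partialSum k c p D + ι T * ι (sumBelow D W) * frac (+ 1) n
    truncated-bound n T D n>0 A A-unique A⊆[n] A-free =
      subst (λ S → frac (+ length A) n ≤ℚ 1ℚ - partial T * S + ι T * ι (sumBelow D W) * frac (+ 1) n)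
            (sym (partialSum≡ D)) density-bound
      where
      open CubePacking.Cubes (suc k″) p p-prime p-increasing n T using (layer; layer-size; module Deficiency)
      open Deficiency A A-unique A⊆[n] A-free c isMoser using (packing; weight)
      a = fitting n
      W-bound : ∀ e → W e ℕ.* sumBelow T (a e) ℕ.≤ length (layer (suc e)) ℕ.* weight e
      W-bound e = begin
        weight e ℕ.* φ (P (suc e)) ℕ.* sumBelow T (a e)             ≡⟨ rearrange (weight e) (φ (P (suc e))) (sumBelow T (a e)) ⟩
        sumBelow T (a e) ℕ.* φ (P (suc e)) ℕ.* weight e             ≡⟨ cong (ℕ._* weight e) (sym (sumBelow-*ʳ T (a e) (φ (P (suc e))))) ⟩
        sumBelow T (λ t → a e t ℕ.* φ (P (suc e))) ℕ.* weight e     ≤⟨ ℕ.*-monoˡ-≤ (weight e) (layer-size e (a e) (fitting-fits n e)) ⟩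
        length (layer (suc e)) ℕ.* weight e                         ∎
        where
        open ℕ.≤-Reasoning
        rearrange : ∀ w f s → w ℕ.* f ℕ.* s ≡ s ℕ.* f ℕ.* w
        rearrange = solve-∀
      packing′ : length A ℕ.+ sumBelow D (λ e → W e ℕ.* sumBelow T (a e)) ℕ.≤ n
      packing′ = ℕ.≤-trans (ℕ.+-monoʳ-≤ (length A) (sumBelow-mono D _ _ W-bound)) (packing D)
      open DensityBound n (length A) R T D n>0 (s≤s z≤n) W Q Q>0 a packing′ (fitting-large n) using (density-bound)

    open SummandBound p p-prime p-increasing k″ c (Cube.moser≤k^d k c isMoser) using (summand-bound)

    open GeometricTail (λ e → frac (+ W e) (Q e)) ρ summand-bound ρ-decay using (tail-bound)

    ≤+nonneg : ∀ {x y} → 0ℚ ≤ℚ y → x ≤ℚ x + y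
    ≤+nonneg {x} y≥0 = ℚ.≤-trans (ℚ.≤-reflexive (sym (ℚ.+-identityʳ x))) (ℚ.+-monoʳ-≤ x y≥0)

    partialSum-tail : ∀ D₁ D → D₁ ℕ.≤ D → partialSum k c p D ≤ℚ partialSum k c p D₁ + ι 3 * ρ D₁
    partialSum-tail D₁ D D₁≤D = subst (λ z → partialSum k c p z ≤ℚ partialSum k c p D₁ + ι 3 * ρ D₁) (ℕ.m+[n∸m]≡n D₁≤D)
      (ℚ.≤-trans (ℚ.≤-reflexive (partialSum≡ (D₁ ℕ.+ j)))
      (ℚ.≤-trans (≤+nonneg (3ρ≥0 (D₁ ℕ.+ j)))
      (ℚ.≤-trans (tail-bound D₁ j)
        (ℚ.≤-reflexive (cong (λ z → z + ι 3 * ρ D₁) (sym (partialSum≡ D₁)))))))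
      where j = D ℕ.∸ D₁

    partialSum≤3 : ∀ D → partialSum k c p D ≤ℚ ι 3
    partialSum≤3 D = ℚ.≤-trans (partialSum-tail 0 D z≤n) (ℚ.≤-reflexive (trans (ℚ.+-identityˡ _) (ℚ.*-identityʳ (ι 3))))

    partialSum≥0 : ∀ D → 0ℚ ≤ℚ partialSum k c p D
    partialSum≥0 D = ℚ.≤-trans (sumℚ-nonneg D _ (λ e → frac≥0 (W e) (Q e))) (ℚ.≤-reflexive (sym (partialSum≡ D)))


open import Defs
open import Data.Nat as ℕ using (ℕ; _≤_; suc; z≤n; s≤s)
import Data.Nat.Properties as ℕ
open import Data.Integer using (+_)
open import Data.Rational using (ℚ; 0ℚ; 1ℚ; _<_; _+_; _-_; _*_) renaming (_≤_ to _≤ℚ_)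
import Data.Rational.Properties as ℚ
open import Data.Product using (∃-syntax; _,_; proj₁; proj₂)
open import Relation.Binary.PropositionalEquality using (sym; subst)
open FiniteSums using (sumBelow)
open Estimates using (unit-fraction-below; collect-errors; module GeometricSeries)
open Conclusion

-- Given ε > 0 choose 1/M ≤ ε, T = 18 M and D₁ = 54 M, and
-- N > T K_{D₁} · 3M.  For n ≥ N and D ≥ D₁ the truncated density bound with
-- parameters T and D₁, applied to a maximal GP_k-free subset of [n], gives
--   G(n)/n ≤ 1 - f S_D + (f (S_D - S_{D₁}) + f R^(-T) S_{D₁} + T K / n)
-- (f = 2^k/(2^k - 1), S = partial sums), and each error term is ≤ 1/(3M).
mainTheorem4 : (k : ℕ) → 3 ≤ k →
  (G : ℕ → ℕ) → (∀ n → IsMaxGPFree k n (G n)) →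
  (c : ℕ → ℕ) → (∀ d → IsMoserNumber d k (c d)) →
  (p : ℕ → ℕ) → IsPrimeEnumeration p →
  (ε : ℚ) → 0ℚ < ε →
  ∃[ N ] (∀ n → N ≤ n → ∃[ D₀ ] (∀ D → D₀ ≤ D →
    frac (+ G n) n ≤ℚ (1ℚ - factor k * partialSum k c p D) + ε))
mainTheorem4 (suc (suc (suc k″))) (s≤s (s≤s (s≤s z≤n))) G isMaxGPFree c isMoser p isPrimeEnumeration ε ε>0 =
  N , λ n N≤n → D₁ , λ D D₁≤D → bound n N≤n D D₁≤D
  where
  open Truncation k″ c isMoser p isPrimeEnumeration
  open GeometricSeries r using (partial≡)
  M = proj₁ (unit-fraction-below ε ε>0)
  M>0 = proj₁ (proj₂ (unit-fraction-below ε ε>0))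
  1/M≤ε = proj₂ (proj₂ (unit-fraction-below ε ε>0))
  open ErrorTerms r M M>0
  N = suc (T ℕ.* sumBelow D₁ W ℕ.* (3 ℕ.* M))
  bound : ∀ n → N ≤ n → ∀ D → D₁ ≤ D → frac (+ G n) n ≤ℚ (1ℚ - factor k * partialSum k c p D) + ε
  bound n N≤n D D₁≤D with proj₁ (isMaxGPFree n)
  ... | (A , A-unique , A⊆[n] , A-free , |A|≡Gn) =
    subst (λ f → frac (+ G n) n ≤ℚ (1ℚ - f * partialSum k c p D) + ε) (sym factor≡limit)
      (collect-errors (subst (λ m → frac (+ m) n ≤ℚ _) |A|≡Gn
                        (truncated-bound n T D₁ (ℕ.≤-trans (s≤s z≤n) N≤n) A A-unique A⊆[n] A-free))
                      (partial≡ T) (partialSum-tail D₁ D D₁≤D) limit≥0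
                      tail-error (geometric-error (partialSum≥0 D₁) (partialSum≤3 D₁))
                      (rounding-error (sumBelow D₁ W) n N≤n) (ℚ.≤-trans three-thirds 1/M≤ε))
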